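{- Let $a<b$ be positive integers and $A=\{a,b,a+b\}$. Let $k=\lfloor (b-1)/(2a)\rfloor$, let $\tilde a=a/\gcd(a,b)$, for $i\ge1$ let $\sigma_i\in\{0,\ldots,a-1\}$ be the residue of $ib$ modulo $a$, and let $\delta_1=0$ and, for $i\geq 2$, $\delta_i=1$ if $\sigma_i>\sigma_{i-1}$ and $\delta_i=0$ otherwise. If the residue of $b$ modulo $2a$ lies in $\{1,\ldots,a-1\}$, then $$(w^A(n))_{n\ge0}=\Big(X_1X_2\cdots X_{\tilde a-1}\,(0^a1^a)^k1^b\Big)^\infty,\qquad X_i=(0^a1^a)^{k-\delta_i}0^{\sigma_i}1^b0^{a-\sigma_i}1^a,$$ and $\operatorname{per}(A)=\tilde a(3b-2ka)$. Otherwise $(w^A(n))_{n\ge0}=\big((0^a1^a)^k0^a1^{a+b}\big)^\infty$ and $\operatorname{per}(A)=b+2a(k+1)$.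
   Context: For a finite nonempty set $A$ of positive integers, $w^A:\mathbb{Z}\to\{0,1\}$ is defined by $w^A(n)=1$ for $n<0$ and $w^A(n)=1-\min\{w^A(n-x):x\in A\}$ for $n\geq 0$ (so $w^A(n)=1$ iff the first player wins the subtraction game with move set $A$ starting from $n$ chips). $\operatorname{per}(A)$ is the least $p\geq1$ such that $w^A(n)=w^A(n+p)$ for all sufficiently large $n$. Notation: juxtaposition is concatenation of binary strings, $0^m,1^m$ are strings of $m$ zeros/ones, $X^m$ is $m$-fold repetition, and $X^\infty$ the infinite repetition of $X$. -}

module Defs where

open import Data.Bool using (Bool; true; false; not; _∨_; _∧_; if_then_else_)
open import Data.Nat using (ℕ; zero; suc; _+_; _*_; _∸_; _≤_; _<_; _≤ᵇ_; _<ᵇ_; NonZero; ≢-nonZero; ≢-nonZero⁻¹)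
open import Data.Nat.Properties using (m*n≢0)
open import Data.Nat.DivMod using (_/_; _%_; _mod_)
open import Data.Nat.GCD using (gcd; gcd[m,n]≢0)
open import Data.List using (List; []; _∷_; _++_; replicate; concat; map; upTo; length; lookup)
open import Data.Bool.ListAction using (any)
open import Data.Sum using (inj₁)
open import Data.Product using (Σ; _×_; ∃)
open import Relation.Binary.PropositionalEquality using (_≡_)

-- Convention: true = 1 (first player wins), false = 0.

-- w^A(n) for n ≥ 0, computed with fuel f (any f > n gives the true value,
-- since every move x ∈ A is positive, so n ∸ x < n whenever x ≤ n).
-- w^A(n) = 1 iff some x ∈ A has x ≤ n and w^A(n - x) = 0
-- (for n - x < 0 the value w^A(n - x) = 1, which never makes a move winning).
wAux : List ℕ → ℕ → ℕ → Bool
wAux A zero    n = true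
wAux A (suc f) n = any (λ x → (x ≤ᵇ n) ∧ not (wAux A f (n ∸ x))) A

w : List ℕ → ℕ → Bool
w A n = wAux A (suc n) n

IsEventualPeriod : List ℕ → ℕ → Set
IsEventualPeriod A p = ∃ λ N → ∀ n → N ≤ n → w A n ≡ w A (n + p)

PerIs : List ℕ → ℕ → Set
PerIs A p = (1 ≤ p) × IsEventualPeriod A p × (∀ q → 1 ≤ q → IsEventualPeriod A q → p ≤ q)

-- X^∞ as a function ℕ → Bool (n-th letter, 0-indexed); the empty word is never used.
infRep : List Bool → ℕ → Bool
infRep []       n = false
infRep (x ∷ xs) n = lookup (x ∷ xs) (n mod suc (length xs))

SeqIs : List ℕ → List Bool → Set
SeqIs A S = ∀ n → w A n ≡ infRep S n

O : ℕ → List Bool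
O m = replicate m false
I : ℕ → List Bool
I m = replicate m true

pow : List Bool → ℕ → List Bool
pow X m = concat (replicate m X)

module _ (a b : ℕ) .{{_ : NonZero a}} where

  private
    instance
      nz2a : NonZero (2 * a)
      nz2a = m*n≢0 2 a
      nzg : NonZero (gcd a b)
      nzg = ≢-nonZero (gcd[m,n]≢0 a b (inj₁ (≢-nonZero⁻¹ a)))

  kk : ℕ
  kk = (b ∸ 1) / (2 * a)

  atilde : ℕ
  atilde = a / gcd a b

  sigma : ℕ → ℕ
  sigma i = (i * b) % a

  delta : ℕ → ℕ
  delta zero          = 0    -- unused
  delta (suc zero)    = 0
  delta (suc (suc j)) = if sigma (suc j) <ᵇ sigma (suc (suc j)) then 1 else 0

  Xw : ℕ → List Bool
  Xw i = pow (O a ++ I a) (kk ∸ delta i) ++ O (sigma i) ++ I b ++ O (a ∸ sigma i) ++ I a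

  word1 : List Bool
  word1 = concat (map (λ j → Xw (suc j)) (upTo (atilde ∸ 1))) ++ pow (O a ++ I a) kk ++ I b

  word2 : List Bool
  word2 = pow (O a ++ I a) kk ++ O a ++ I (a + b)

  Cond : Set
  Cond = (1 ≤ b % (2 * a)) × (b % (2 * a) ≤ a ∸ 1)

module Submission where

-- Writing W y = w^A(y − (a + b)) turns the game into the recurrence
-- W(y + a + b) = ¬(W(y + b) ∧ W(y + a) ∧ W y), whose state is a window of a + b
-- consecutive values. The all-ones window is the initial state, so W is periodic from
-- the start as soon as that window recurs, and the period is minimal when no all-ones
-- window occurs strictly inside one period. Write b = r + 2ak with 1 ≤ r ≤ 2a. Entered
-- from the window 1^{b-a+σ} 0^{a-σ} 1^a, the sequence continues with a block of squares
-- 0^a 1^a, then 0^{σ'} 1^b 0^{a-σ'} 1^a, and arrives in the window for σ' ≡ σ + r (mod a).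
-- If a ≤ r a single block leads back to the all-ones window; if r < a the windows run
-- through σ_i ≡ i·b (mod a) and return to the all-ones window after ã blocks.

open import Data.Bool as Bool using (Bool; true; false; not; _∨_; _∧_; if_then_else_)
open import Data.Bool.Properties using (T-≡; not-involutive)
open import Data.Nat
open import Data.Nat.Properties
open import Data.Nat.DivMod
open import Data.Nat.Divisibility using (_∣_; m%n≡0⇒n∣m; ∣⇒≤; *-cancelʳ-∣)
open import Data.Nat.GCD using (gcd; gcd[m,n]≢0; gcd[m,n]∣m; gcd[m,n]∣n)
open import Data.Nat.Coprimality using (coprime-/gcd; coprime-divisor)
open import Data.List using (List; []; _∷_; _++_; replicate; concat; map; length; lookup; applyUpTo)
open import Data.List.Properties using (++-assoc; ++-identityʳ; length-++; length-replicate)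
open import Data.Fin using (Fin; toℕ) renaming (zero to fzero; suc to fsuc)
open import Data.Fin.Properties using (toℕ-fromℕ<)
open import Data.Product using (_×_; _,_; ∃)
open import Data.Sum using (_⊎_; inj₁; inj₂; map₁)
open import Data.Empty using (⊥-elim)
open import Data.Unit using (tt)
open import Function.Bundles using (Equivalence)
open import Relation.Nullary using (¬_; yes; no)
open import Relation.Binary.PropositionalEquality hiding (J)
open import Relation.Binary.Definitions using (tri<; tri≈; tri>)
open import Induction.WellFounded using (Acc; acc)
open import Data.Nat.Induction using (<-wellFounded)
open import Data.Nat.Tactic.RingSolver using (solve-∀)
open import Defs

private
  T-false : ∀ {x} → ¬ Bool.T x → x ≡ false
  T-false {false} _ = refl
  T-false {true} ¬t = ⊥-elim (¬t tt)

≤ᵇ-true : ∀ {m n} → m ≤ n → (m ≤ᵇ n) ≡ true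
≤ᵇ-true m≤n = Equivalence.to T-≡ (≤⇒≤ᵇ m≤n)

≤ᵇ-false : ∀ {m n} → n < m → (m ≤ᵇ n) ≡ false
≤ᵇ-false {m} {n} n<m = T-false (λ t → <⇒≱ n<m (≤ᵇ⇒≤ m n t))

<ᵇ-true : ∀ {m n} → m < n → (m <ᵇ n) ≡ true
<ᵇ-true m<n = Equivalence.to T-≡ (<⇒<ᵇ m<n)

<ᵇ-false : ∀ {m n} → n ≤ m → (m <ᵇ n) ≡ false
<ᵇ-false {m} {n} n≤m = T-false (λ t → <⇒≱ (<ᵇ⇒< m n t) n≤m)


-- Indexing into finite words

-- Total indexing; positions past the end read 1, matching w^A on negative arguments.
at : List Bool → ℕ → Bool
at [] _ = true
at (x ∷ xs) zero = x
at (x ∷ xs) (suc n) = at xs n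

lookup-at : ∀ xs (i : Fin (length xs)) → lookup xs i ≡ at xs (toℕ i)
lookup-at (x ∷ xs) fzero = refl
lookup-at (x ∷ xs) (fsuc i) = lookup-at xs i

at-++ˡ : ∀ xs ys n → n < length xs → at (xs ++ ys) n ≡ at xs n
at-++ˡ (x ∷ xs) ys zero _ = refl
at-++ˡ (x ∷ xs) ys (suc n) (s≤s n<) = at-++ˡ xs ys n n<

at-++ʳ : ∀ xs ys n → at (xs ++ ys) (length xs + n) ≡ at ys n
at-++ʳ [] ys n = refl
at-++ʳ (x ∷ xs) ys n = at-++ʳ xs ys n

at-++ : ∀ xs ys n → (n < length xs × at (xs ++ ys) n ≡ at xs n)
                  ⊎ ∃ λ m → n ≡ length xs + m × at (xs ++ ys) n ≡ at ys m
at-++ xs ys n with n <? length xs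
... | yes n< = inj₁ (n< , at-++ˡ xs ys n n<)
... | no n≮ = inj₂ (n ∸ length xs , sym n≡ , trans (cong (at (xs ++ ys)) (sym n≡)) (at-++ʳ xs ys (n ∸ length xs)))
  where
  n≡ : length xs + (n ∸ length xs) ≡ n
  n≡ = m+[n∸m]≡n (≮⇒≥ n≮)

at-replicate : ∀ m (x : Bool) n → n < m → at (replicate m x) n ≡ x
at-replicate (suc m) x zero _ = refl
at-replicate (suc m) x (suc n) (s≤s n<) = at-replicate m x n n<

at-replicate-true : ∀ m n → at (replicate m true) n ≡ true
at-replicate-true zero n = refl
at-replicate-true (suc m) zero = refl
at-replicate-true (suc m) (suc n) = at-replicate-true m n

replicate-++ : ∀ m n (x : Bool) → replicate m x ++ replicate n x ≡ replicate (m + n) x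
replicate-++ zero n x = refl
replicate-++ (suc m) n x = cong (x ∷_) (replicate-++ m n x)

pow-suc : ∀ (X : List Bool) m → pow X (suc m) ≡ pow X m ++ X
pow-suc X zero = ++-identityʳ X
pow-suc X (suc m) = trans (cong (X ++_) (pow-suc X m)) (sym (++-assoc X (pow X m) X))


-- The square wave (0^a 1^a)^∞

isOdd : ℕ → Bool
isOdd zero = false
isOdd (suc n) = not (isOdd n)

module Wave (a : ℕ) .{{_ : NonZero a}} where

  2a : ℕ
  2a = a + a

  wave : ℕ → Bool
  wave v = isOdd (v / a)

  wave-+a : ∀ v → wave (v + a) ≡ not (wave v)
  wave-+a v = cong isOdd (trans (m/n≡1+[m∸n]/n (m≤n+m a v)) (cong (λ z → suc (z / a)) (m+n∸n≡m v a)))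

  wave-+2a : ∀ v → wave (v + 2a) ≡ wave v
  wave-+2a v = begin
      wave (v + (a + a)) ≡⟨ cong wave (sym (+-assoc v a a)) ⟩
      wave (v + a + a)   ≡⟨ wave-+a (v + a) ⟩
      not (wave (v + a)) ≡⟨ cong not (wave-+a v) ⟩
      not (not (wave v)) ≡⟨ not-involutive (wave v) ⟩
      wave v             ∎
    where open ≡-Reasoning

  wave-+*2a : ∀ j v → wave (v + j * 2a) ≡ wave v
  wave-+*2a zero v = cong wave (+-identityʳ v)
  wave-+*2a (suc j) v = begin
      wave (v + (2a + j * 2a)) ≡⟨ cong wave (sym (+-assoc v 2a (j * 2a))) ⟩
      wave (v + 2a + j * 2a)   ≡⟨ wave-+*2a j (v + 2a) ⟩
      wave (v + 2a)            ≡⟨ wave-+2a v ⟩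
      wave v                   ∎
    where open ≡-Reasoning

  wave-low : ∀ v → v < a → wave v ≡ false
  wave-low v v<a = cong isOdd (m<n⇒m/n≡0 v<a)

  wave-high : ∀ v → a ≤ v → v < 2a → wave v ≡ true
  wave-high v a≤v v<2a = begin
      wave v                 ≡⟨ cong wave (sym (m∸n+n≡m a≤v)) ⟩
      wave (v ∸ a + a)       ≡⟨ wave-+a (v ∸ a) ⟩
      not (wave (v ∸ a))     ≡⟨ cong not (wave-low (v ∸ a) v∸a<a) ⟩
      true                   ∎
    where
    open ≡-Reasoning
    v∸a<a : v ∸ a < a
    v∸a<a = +-cancelʳ-< a (v ∸ a) a (subst (_< a + a) (sym (m∸n+n≡m a≤v)) v<2a)

  square : List Bool
  square = O a ++ I a

  length-square : length square ≡ 2a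
  length-square = trans (length-++ (O a)) (cong₂ _+_ (length-replicate a) (length-replicate a))

  length-pow-square : ∀ j → length (pow square j) ≡ j * 2a
  length-pow-square zero = refl
  length-pow-square (suc j) = trans (length-++ square) (cong₂ _+_ length-square (length-pow-square j))

  at-square : ∀ t → t < 2a → at square t ≡ wave t
  at-square t t<2a with at-++ (O a) (I a) t
  ... | inj₁ (t< , e) = trans e (trans (at-replicate a false t t<a) (sym (wave-low t t<a)))
    where
    t<a = subst (t <_) (length-replicate a) t<
  ... | inj₂ (m , refl , e) = trans e (trans (at-replicate a true m m<a) (sym (wave-high _ a≤t t<2a)))
    where
    a≤t = subst (_≤ length (O a) + m) (length-replicate a) (m≤m+n _ m)
    m<a = +-cancelˡ-< a m a (subst (λ l → l + m < a + a) (length-replicate a) t<2a)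

  at-pow-square : ∀ j t → t < j * 2a → at (pow square j) t ≡ wave t
  at-pow-square (suc j) t t< with at-++ square (pow square j) t
  ... | inj₁ (t<sq , e) = trans e (at-square t (subst (t <_) length-square t<sq))
  ... | inj₂ (m , refl , e) = begin
      at (pow square (suc j)) (length square + m) ≡⟨ e ⟩
      at (pow square j) m                         ≡⟨ at-pow-square j m m< ⟩
      wave m                                      ≡⟨ sym (wave-+2a m) ⟩
      wave (m + 2a)                               ≡⟨ cong wave (trans (+-comm m 2a) (cong (_+ m) (sym length-square))) ⟩
      wave (length square + m)                    ∎
    where
    open ≡-Reasoning
    m< : m < j * 2a
    m< = +-cancelˡ-< 2a m (j * 2a) (subst (λ l → l + m < 2a + j * 2a) length-square t<)

-- The subtraction game with moves {a, b, a + b}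

module Game (a b : ℕ) (1≤a : 1 ≤ a) (a<b : a < b) where

  moves : List ℕ
  moves = a ∷ b ∷ (a + b) ∷ []

  1≤b : 1 ≤ b
  1≤b = ≤-trans 1≤a (<⇒≤ a<b)

  1≤a+b : 1 ≤ a + b
  1≤a+b = ≤-trans 1≤a (m≤m+n a b)

  rule : (ℕ → Bool) → ℕ → Bool
  rule F y = not (F (y + b) ∧ F (y + a) ∧ F y)

  Solves : (ℕ → Bool) → Set
  Solves F = ∀ y → F (y + (a + b)) ≡ rule F y

  wAux-fuel : ∀ f g n → n < f → n < g → wAux moves f n ≡ wAux moves g n
  wAux-fuel (suc f) (suc g) n (s≤s n<f) (s≤s n<g) =
    cong₂ _∨_ (move a 1≤a) (cong₂ _∨_ (move b 1≤b) (cong₂ _∨_ (move (a + b) 1≤a+b) refl))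
    where
    move : ∀ x → 1 ≤ x → ((x ≤ᵇ n) ∧ not (wAux moves f (n ∸ x))) ≡ ((x ≤ᵇ n) ∧ not (wAux moves g (n ∸ x)))
    move x 1≤x with x ≤? n
    ... | no x≰n rewrite ≤ᵇ-false {x} {n} (≰⇒> x≰n) = refl
    ... | yes x≤n = cong (λ z → (x ≤ᵇ n) ∧ not z)
                     (wAux-fuel f g (n ∸ x) (<-≤-trans (∸-monoʳ-< 1≤x x≤n) n<f)
                                            (<-≤-trans (∸-monoʳ-< 1≤x x≤n) n<g))

  -- The value 1 below a + b stands for w^A on negative arguments.
  W : ℕ → Bool
  W y = if (a + b) ≤ᵇ y then w moves (y ∸ (a + b)) else true

  W-low : ∀ y → y < a + b → W y ≡ true
  W-low y y< rewrite ≤ᵇ-false {a + b} {y} y< = refl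

  W-shift : ∀ y → W (y + (a + b)) ≡ w moves y
  W-shift y rewrite ≤ᵇ-true {a + b} {y + (a + b)} (m≤n+m (a + b) y) | m+n∸n≡m y (a + b) = refl

  w≡W : ∀ n → w moves n ≡ W (a + b + n)
  w≡W n = trans (sym (W-shift n)) (cong W (+-comm n (a + b)))

  private
    move-W : ∀ y x s → 1 ≤ x → x + s ≡ a + b →
             ((x ≤ᵇ y) ∧ not (wAux moves y (y ∸ x))) ≡ not (W (y + s))
    move-W y x s 1≤x x+s≡ with x ≤? y
    ... | no x≰y rewrite ≤ᵇ-false {x} {y} (≰⇒> x≰y)
                      | W-low (y + s) (subst (y + s <_) x+s≡ (+-monoˡ-< s (≰⇒> x≰y))) = refl
    ... | yes x≤y rewrite ≤ᵇ-true x≤y =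
      cong not (trans (wAux-fuel y (suc (y ∸ x)) (y ∸ x) (∸-monoʳ-< 1≤x x≤y) ≤-refl) (sym W-y+s))
      where
      y+s≡ : y + s ≡ y ∸ x + (a + b)
      y+s≡ = begin
          y + s           ≡⟨ cong (_+ s) (sym (m∸n+n≡m x≤y)) ⟩
          y ∸ x + x + s   ≡⟨ +-assoc (y ∸ x) x s ⟩
          y ∸ x + (x + s) ≡⟨ cong (y ∸ x +_) x+s≡ ⟩
          y ∸ x + (a + b) ∎
        where open ≡-Reasoning
      W-y+s : W (y + s) ≡ w moves (y ∸ x)
      W-y+s = trans (cong W y+s≡) (W-shift (y ∸ x))

    deMorgan : ∀ p q r → (not p ∨ (not q ∨ (not r ∨ false))) ≡ not (p ∧ q ∧ r)
    deMorgan true true true = refl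
    deMorgan true true false = refl
    deMorgan true false r = refl
    deMorgan false q r = refl

  W-solves : Solves W
  W-solves y = begin
      W (y + (a + b))
    ≡⟨ W-shift y ⟩
      w moves y
    ≡⟨ cong₂ _∨_ (move-W y a b 1≤a refl) (cong₂ _∨_ (move-W y b a 1≤b (+-comm b a))
         (cong₂ _∨_ (move-W y (a + b) 0 1≤a+b (+-identityʳ _)) refl)) ⟩
      not (W (y + b)) ∨ (not (W (y + a)) ∨ (not (W (y + 0)) ∨ false))
    ≡⟨ cong (λ z → not (W (y + b)) ∨ (not (W (y + a)) ∨ (not (W z) ∨ false))) (+-identityʳ y) ⟩
      not (W (y + b)) ∨ (not (W (y + a)) ∨ (not (W y) ∨ false))
    ≡⟨ deMorgan (W (y + b)) (W (y + a)) (W y) ⟩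
      rule W y
    ∎
    where open ≡-Reasoning

  ZeroAhead : (ℕ → Bool) → ℕ → Set
  ZeroAhead F y = ∃ λ i → i < a + b × F (y + i) ≡ false

  zero-at : ∀ F y z → y ≤ z → z < y + (a + b) → F z ≡ false → ZeroAhead F y
  zero-at F y z y≤z z< Fz≡false =
    z ∸ y , +-cancelˡ-< y (z ∸ y) (a + b) (subst (_< y + (a + b)) (sym (m+[n∸m]≡n y≤z)) z<) ,
    trans (cong F (m+[n∸m]≡n y≤z)) Fz≡false

  solutions-agree : ∀ (F H : ℕ → Bool) U →
         (∀ y → y + (a + b) < U → F (y + (a + b)) ≡ rule F y) →
         (∀ y → y + (a + b) < U → H (y + (a + b)) ≡ rule H y) →
         (∀ y → y < a + b → F y ≡ H y) →
         ∀ y → y < U → F y ≡ H y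
  solutions-agree F H U F-solves H-solves initial y = go y (<-wellFounded y)
    where
    go : ∀ y → Acc _<_ y → y < U → F y ≡ H y
    go y (acc rs) y<U with y <? a + b
    ... | yes y< = initial y y<
    ... | no y≮ = begin
          F y               ≡⟨ cong F (sym z+ab≡y) ⟩
          F (z + (a + b))   ≡⟨ F-solves z (subst (_< U) (sym z+ab≡y) y<U) ⟩
          rule F z          ≡⟨ cong₃ (go (z + b) (rs lt-b) (<-trans lt-b y<U))
                                     (go (z + a) (rs lt-a) (<-trans lt-a y<U))
                                     (go z (rs lt-0) (<-trans lt-0 y<U)) ⟩
          rule H z          ≡⟨ sym (H-solves z (subst (_< U) (sym z+ab≡y) y<U)) ⟩
          H (z + (a + b))   ≡⟨ cong H z+ab≡y ⟩
          H y               ∎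
      where
      open ≡-Reasoning
      z = y ∸ (a + b)
      z+ab≡y : z + (a + b) ≡ y
      z+ab≡y = m∸n+n≡m (≮⇒≥ y≮)
      cong₃ : ∀ {p p' q q' r r'} → p ≡ p' → q ≡ q' → r ≡ r' → not (p ∧ q ∧ r) ≡ not (p' ∧ q' ∧ r')
      cong₃ refl refl refl = refl
      lt-b : z + b < y
      lt-b = subst (z + b <_) z+ab≡y (+-monoʳ-< z (subst (b <_) (+-comm b a) (m<m+n b 1≤a)))
      lt-a : z + a < y
      lt-a = subst (z + a <_) z+ab≡y (+-monoʳ-< z (m<m+n a 1≤b))
      lt-0 : z < y
      lt-0 = subst (z <_) z+ab≡y (m<m+n z 1≤a+b)

  shift-solves : ∀ F Q → Solves F → Solves (λ z → F (Q + z))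
  shift-solves F Q F-solves y = begin
      F (Q + (y + (a + b))) ≡⟨ cong F (sym (+-assoc Q y (a + b))) ⟩
      F (Q + y + (a + b))   ≡⟨ F-solves (Q + y) ⟩
      rule F (Q + y)        ≡⟨ cong₂ (λ p q → not (p ∧ q ∧ F (Q + y)))
                                     (cong F (+-assoc Q y b)) (cong F (+-assoc Q y a)) ⟩
      rule (λ z → F (Q + z)) y ∎
    where open ≡-Reasoning

  -- A window of a + b ones is the initial state, so the game starts afresh after it.
  W-restart : ∀ Q → (∀ y → y < a + b → W (Q + y) ≡ true) → ∀ y → W (Q + y) ≡ W y
  W-restart Q ones y = solutions-agree (λ z → W (Q + z)) W (suc y)
      (λ z _ → shift-solves W Q W-solves z) (λ z _ → W-solves z)
      (λ z z< → trans (ones z z<) (sym (W-low z z<))) y ≤-refl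

  -- From Q on, W reads R and then returns to the initial state, which it never
  -- passes through strictly inside R.
  record Describes (Q : ℕ) (R : List Bool) : Set where
    field
      reads : ∀ t → t < length R → W (Q + (a + b) + t) ≡ at R t
      restarts : ∀ y → y < a + b → W (Q + length R + y) ≡ true
      no-restart : ∀ y → 1 ≤ y → y < length R → ZeroAhead W (Q + y)

  Describes-++ : ∀ Q B R →
           (∀ t → t < length B → W (Q + (a + b) + t) ≡ at B t) →
           (∀ y → 1 ≤ y → y ≤ length B → ZeroAhead W (Q + y)) →
           Describes (Q + length B) R → Describes Q (B ++ R)
  Describes-++ Q B R B-reads B-no-restart D = record
    { reads = reads′ ; restarts = restarts′ ; no-restart = no-restart′ }
    where
    open Describes D
    reads′ : ∀ t → t < length (B ++ R) → W (Q + (a + b) + t) ≡ at (B ++ R) t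
    reads′ t t< with at-++ B R t
    ... | inj₁ (t<B , e) = trans (B-reads t t<B) (sym e)
    ... | inj₂ (m , refl , e) = trans (cong W (regroup Q (a + b) (length B) m))
            (trans (reads m (+-cancelˡ-< (length B) m (length R) (subst (length B + m <_) (length-++ B) t<))) (sym e))
      where
      regroup : ∀ Q c l m → Q + c + (l + m) ≡ Q + l + c + m
      regroup = solve-∀
    restarts′ : ∀ y → y < a + b → W (Q + length (B ++ R) + y) ≡ true
    restarts′ y y< = trans (cong (λ z → W (z + y)) (trans (cong (Q +_) (length-++ B)) (sym (+-assoc Q (length B) (length R)))))
                           (restarts y y<)
    no-restart′ : ∀ y → 1 ≤ y → y < length (B ++ R) → ZeroAhead W (Q + y)
    no-restart′ y 1≤y y< with y ≤? length B
    ... | yes y≤B = B-no-restart y 1≤y y≤B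
    ... | no y≰B with no-restart (y ∸ length B) (m<n⇒0<n∸m B<y)
                       (+-cancelˡ-< (length B) (y ∸ length B) (length R) (subst₂ _<_ (sym y≡) (length-++ B) y<))
      where
      B<y = ≰⇒> y≰B
      y≡ : length B + (y ∸ length B) ≡ y
      y≡ = m+[n∸m]≡n (<⇒≤ B<y)
    ...   | i , i< , e = i , i< , trans (cong (λ z → W (z + i)) (trans (cong (Q +_) (sym y≡)) (sym (+-assoc Q (length B) _)))) e
      where
      y≡ : length B + (y ∸ length B) ≡ y
      y≡ = m+[n∸m]≡n (<⇒≤ (≰⇒> y≰B))

  module _ (x : Bool) (xs : List Bool) (D : Describes 0 (x ∷ xs)) where
    open Describes D

    private
      L : ℕ
      L = suc (length xs)

    W-periodic : ∀ k y → W (k * L + y) ≡ W y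
    W-periodic zero y = refl
    W-periodic (suc k) y = trans (cong W (+-assoc L (k * L) y))
                                 (trans (W-restart L restarts (k * L + y)) (W-periodic k y))

    word-sequence : SeqIs moves (x ∷ xs)
    word-sequence n = begin
        w moves n                        ≡⟨ w≡W n ⟩
        W (a + b + n)                    ≡⟨ cong (λ z → W (a + b + z)) (m≡m%n+[m/n]*n n L) ⟩
        W (a + b + (n % L + n / L * L))  ≡⟨ cong W (regroup (a + b) (n % L) (n / L * L)) ⟩
        W (n / L * L + (a + b + n % L))  ≡⟨ W-periodic (n / L) (a + b + n % L) ⟩
        W (a + b + n % L)                ≡⟨ reads (n % L) (m%n<n n L) ⟩
        at (x ∷ xs) (n % L)              ≡⟨ cong (at (x ∷ xs)) (sym (toℕ-fromℕ< (m%n<n n L))) ⟩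
        at (x ∷ xs) (toℕ (n mod L))      ≡⟨ sym (lookup-at (x ∷ xs) (n mod L)) ⟩
        infRep (x ∷ xs) n                ∎
      where
      open ≡-Reasoning
      regroup : ∀ c m k → c + (m + k) ≡ k + (c + m)
      regroup = solve-∀

    word-period : IsEventualPeriod moves L
    word-period = 0 , λ n _ → trans (w≡W n) (trans (sym (W-restart L restarts (a + b + n)))
                          (trans (cong W (regroup L (a + b) n)) (sym (w≡W (n + L)))))
      where
      regroup : ∀ L c n → L + (c + n) ≡ c + (n + L)
      regroup = solve-∀

    -- An eventual period q forces W (q + y) ≡ W y: past the preperiod, q shifts a
    -- copy of the all-ones window at a multiple P of L onto P + q, so W restarts there.
    period-shifts-W : ∀ q → IsEventualPeriod moves q → ∀ y → W (q + y) ≡ W y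
    period-shifts-W q (N , per) y = begin
        W (q + y)     ≡⟨ sym (W-periodic (N + ab) (q + y)) ⟩
        W (P + (q + y)) ≡⟨ cong W (sym (+-assoc P q y)) ⟩
        W (P + q + y) ≡⟨ W-restart (P + q) ones y ⟩
        W y           ∎
      where
      open ≡-Reasoning
      ab = a + b
      P = (N + ab) * L
      M = P ∸ ab
      ab+M≡P : ab + M ≡ P
      ab+M≡P = m+[n∸m]≡n (≤-trans (m≤n+m ab N) (m≤m*n (N + ab) L))
      N≤M : N ≤ M
      N≤M = +-cancelˡ-≤ ab N M (subst (_≤ ab + M) (+-comm N ab) (subst (N + ab ≤_) (sym ab+M≡P) (m≤m*n (N + ab) L)))
      regroup : ∀ ab M q i → ab + M + q + i ≡ ab + (M + i + q)
      regroup = solve-∀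
      ones : ∀ i → i < ab → W (P + q + i) ≡ true
      ones i i< = begin
          W (P + q + i)        ≡⟨ cong W (trans (cong (λ z → z + q + i) (sym ab+M≡P)) (regroup ab M q i)) ⟩
          W (ab + (M + i + q)) ≡⟨ sym (w≡W (M + i + q)) ⟩
          w moves (M + i + q)  ≡⟨ sym (per (M + i) (≤-trans N≤M (m≤m+n M i))) ⟩
          w moves (M + i)      ≡⟨ w≡W (M + i) ⟩
          W (ab + (M + i))     ≡⟨ cong W (trans (sym (+-assoc ab M i)) (cong (_+ i) ab+M≡P)) ⟩
          W (P + i)            ≡⟨ W-periodic (N + ab) i ⟩
          W i                  ≡⟨ W-low i i< ⟩
          true                 ∎

    word-period-minimal : ∀ q → 1 ≤ q → IsEventualPeriod moves q → L ≤ q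
    word-period-minimal q 1≤q q-period with L ≤? q
    ... | yes L≤q = L≤q
    ... | no L≰q with no-restart (L ∸ q) (m<n⇒0<n∸m q<L) (∸-monoʳ-< 1≤q (<⇒≤ q<L))
      where q<L = ≰⇒> L≰q
    ...   | i , i< , W≡false with trans (sym W≡false) (trans (sym (period-shifts-W q q-period (L ∸ q + i)))
                                   (trans (cong W (trans (sym (+-assoc q (L ∸ q) i))
                                                         (cong (_+ i) (m+[n∸m]≡n (<⇒≤ (≰⇒> L≰q))))))
                                     (restarts i i<)))
    ...     | ()

    per-word : PerIs moves L
    per-word = s≤s z≤n , word-period , word-period-minimal

  describes⇒periodic : ∀ R → 1 ≤ length R → Describes 0 R → SeqIs moves R × PerIs moves (length R)
  describes⇒periodic (x ∷ xs) _ D = word-sequence x xs D , per-word x xs D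

-- ã = a / gcd(a, b) is the order of b modulo a

module Order (a b : ℕ) .{{_ : NonZero a}} where

  private
    g : ℕ
    g = gcd a b

    instance
      g≢0 : NonZero g
      g≢0 = ≢-nonZero (gcd[m,n]≢0 a b (inj₁ (≢-nonZero⁻¹ a)))

    ã*g≡a : atilde a b * g ≡ a
    ã*g≡a = m/n*n≡m (gcd[m,n]∣m a b)

    b/g*g≡b : b / g * g ≡ b
    b/g*g≡b = m/n*n≡m (gcd[m,n]∣n a b)

  [ã*b]%a≡0 : (atilde a b * b) % a ≡ 0
  [ã*b]%a≡0 = trans (cong (_% a) ã*b≡b/g*a) (m*n%n≡0 (b / g) a)
    where
    open ≡-Reasoning
    swap : ∀ x y z → x * (y * z) ≡ y * (x * z)
    swap = solve-∀
    ã*b≡b/g*a : atilde a b * b ≡ b / g * a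
    ã*b≡b/g*a = begin
        atilde a b * b             ≡⟨ cong (atilde a b *_) (sym b/g*g≡b) ⟩
        atilde a b * (b / g * g)   ≡⟨ swap (atilde a b) (b / g) g ⟩
        b / g * (atilde a b * g)   ≡⟨ cong (b / g *_) ã*g≡a ⟩
        b / g * a                  ∎

  [i*b]%a≢0 : ∀ i → 1 ≤ i → i < atilde a b → (i * b) % a ≢ 0
  [i*b]%a≢0 i@(suc _) _ i<ã [i*b]%a≡0 = <⇒≱ i<ã (∣⇒≤ ã∣i)
    where
    g∣ : atilde a b * g ∣ (i * (b / g)) * g
    g∣ = subst₂ _∣_ (sym ã*g≡a) (trans (cong (i *_) (sym b/g*g≡b)) (sym (*-assoc i (b / g) g)))
                    (m%n≡0⇒n∣m (i * b) a [i*b]%a≡0)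
    ã∣i : atilde a b ∣ i
    ã∣i = coprime-divisor (coprime-/gcd a b) (subst (atilde a b ∣_) (*-comm i (b / g)) (*-cancelʳ-∣ g g∣))

  2≤ã : b % a ≢ 0 → 2 ≤ atilde a b
  2≤ã b%a≢0 with atilde a b in ã≡
  ... | zero = ⊥-elim (≢-nonZero⁻¹ a (trans (sym ã*g≡a) (cong (_* g) ã≡)))
  ... | suc zero = ⊥-elim (b%a≢0 (trans (cong (_% a) (sym (+-identityʳ b)))
                                        (trans (cong (λ z → (z * b) % a) (sym ã≡)) [ã*b]%a≡0)))
  ... | suc (suc _) = s≤s (s≤s z≤n)

-- One block of the sequence

-- With b = a + d, the windows of a + b consecutive values of W between blocks have the
-- form 1^{d+s} 0^{a-s} 1^a with 1 ≤ s ≤ a; the initial all-ones window is the case s = a.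
module Block (a d : ℕ) .{{_ : NonZero a}} (1≤a : 1 ≤ a) (1≤d : 1 ≤ d) where
  open Wave a

  b : ℕ
  b = a + d

  a<b : a < b
  a<b = subst (_≤ a + d) (+-comm a 1) (+-monoʳ-≤ a 1≤d)

  open Game a b 1≤a a<b public

  state : ℕ → ℕ → Bool
  state s y = if y <ᵇ d + s then true else if y <ᵇ b then false else true

  state-head : ∀ s y → y < d + s → state s y ≡ true
  state-head s y y< rewrite <ᵇ-true y< = refl

  state-gap : ∀ s y → d + s ≤ y → y < b → state s y ≡ false
  state-gap s y ≤y y< rewrite <ᵇ-false ≤y | <ᵇ-true y< = refl

  state-tail : ∀ s y → d + s ≤ y → b ≤ y → state s y ≡ true
  state-tail s y ≤y b≤y rewrite <ᵇ-false ≤y | <ᵇ-false b≤y = refl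

  state-a : ∀ y → state a y ≡ true
  state-a y with y <? d + a
  ... | yes y< = state-head a y y<
  ... | no y≮ = state-tail a y (≮⇒≥ y≮) (subst (_≤ y) (+-comm d a) (≮⇒≥ y≮))

  split-d : ∀ y → y < d ⊎ ∃ λ s → y ≡ d + s
  split-d y with y <? d
  ... | yes y< = inj₁ y<
  ... | no y≮ = inj₂ (y ∸ d , sym (m+[n∸m]≡n (≮⇒≥ y≮)))

  nand-0₁ : ∀ {x y z} → x ≡ false → not (x ∧ y ∧ z) ≡ true
  nand-0₁ refl = refl

  nand-0₂ : ∀ {x y z} → y ≡ false → not (x ∧ y ∧ z) ≡ true
  nand-0₂ {true} refl = refl
  nand-0₂ {false} refl = refl

  nand-0₃ : ∀ {x y z} → z ≡ false → not (x ∧ y ∧ z) ≡ true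
  nand-0₃ {true} {true} refl = refl
  nand-0₃ {true} {false} refl = refl
  nand-0₃ {false} refl = refl

  nand-111 : ∀ {x y z} → x ≡ true → y ≡ true → z ≡ true → not (x ∧ y ∧ z) ≡ false
  nand-111 refl refl refl = refl

  -- The block (0^a 1^a)^j 0^σ' 1^b 0^(a-σ') 1^a entered from state σ and leaving state σ'.
  -- The values of the block are described in the coordinate v = y ∸ d, in which
  -- the state window 1^{d+σ} 0^{a-σ} 1^a becomes 1^σ followed by the wave.
  module Profile (σ σ' j : ℕ) where

    J : ℕ
    J = 2a + j * 2a

    T : ℕ
    T = J + σ'

    block : List Bool
    block = pow square j ++ O σ' ++ I b ++ O (a ∸ σ') ++ I a

    profile : ℕ → Bool
    profile v = if v <ᵇ σ then true else if v <ᵇ T then wave v else if v <ᵇ T + b then true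
                else if v <ᵇ J + a + b then false else true

    expected : ℕ → Bool
    expected y = if y <ᵇ d then true else profile (y ∸ d)

    profile-head : ∀ v → v < σ → profile v ≡ true
    profile-head v v< rewrite <ᵇ-true v< = refl

    profile-wave : ∀ v → σ ≤ v → v < T → profile v ≡ wave v
    profile-wave v ≤v v< rewrite <ᵇ-false ≤v | <ᵇ-true v< = refl

    profile-ones : ∀ v → σ ≤ v → T ≤ v → v < T + b → profile v ≡ true
    profile-ones v h1 h2 h3 rewrite <ᵇ-false h1 | <ᵇ-false h2 | <ᵇ-true h3 = refl

    profile-zeros : ∀ v → σ ≤ v → T ≤ v → T + b ≤ v → v < J + a + b → profile v ≡ false
    profile-zeros v h1 h2 h3 h4 rewrite <ᵇ-false h1 | <ᵇ-false h2 | <ᵇ-false h3 | <ᵇ-true h4 = refl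

    profile-end : ∀ v → σ ≤ v → T ≤ v → T + b ≤ v → J + a + b ≤ v → profile v ≡ true
    profile-end v h1 h2 h3 h4 rewrite <ᵇ-false h1 | <ᵇ-false h2 | <ᵇ-false h3 | <ᵇ-false h4 = refl

    expected-low : ∀ y → y < d → expected y ≡ true
    expected-low y y< rewrite <ᵇ-true y< = refl

    expected-d+ : ∀ v → expected (d + v) ≡ profile v
    expected-d+ v rewrite <ᵇ-false (m≤m+n d v) | m+n∸m≡n d v = refl

    wave-below-J : ∀ v → J ≤ v + a → v < J → wave v ≡ true
    wave-below-J v J≤v+a v<J = begin
        wave v                  ≡⟨ cong wave (sym x+j*2a≡v) ⟩
        wave (x + j * 2a)       ≡⟨ wave-+*2a j x ⟩
        wave x                  ≡⟨ wave-high x a≤x x<2a ⟩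
        true                    ∎
      where
      open ≡-Reasoning
      j*2a+a≤v : j * 2a + a ≤ v
      j*2a+a≤v = +-cancelʳ-≤ a (j * 2a + a) v (≤-trans (≤-reflexive (shuffle a (j * 2a))) J≤v+a)
        where
        shuffle : ∀ a x → x + a + a ≡ a + a + x
        shuffle = solve-∀
      x = v ∸ j * 2a
      x+j*2a≡v : x + j * 2a ≡ v
      x+j*2a≡v = m∸n+n≡m (≤-trans (m≤m+n (j * 2a) a) j*2a+a≤v)
      a≤x : a ≤ x
      a≤x = +-cancelʳ-≤ (j * 2a) a x (subst₂ _≤_ (+-comm (j * 2a) a) (sym x+j*2a≡v) j*2a+a≤v)
      x<2a : x < 2a
      x<2a = +-cancelʳ-< (j * 2a) x 2a (subst (_< J) (sym x+j*2a≡v) v<J)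

    -- Conditions under which `expected` solves the recurrence; they cover the three
    -- configurations of σ, σ', j that occur below.
    record Fits : Set where
      field
        σ≤a : σ ≤ a
        1≤σ' : 1 ≤ σ'
        σ'≤a : σ' ≤ a
        b+σ≤T : b + σ ≤ T
        T≤b+σ+a : T ≤ b + σ + a
        wave-zeros-late : ∀ v → v < T → wave v ≡ false → σ + b ≤ v → a + b ≤ v
        late-after-J : ∀ v → T ≤ v → a + b ≤ v → v < b + σ + a → J + a ≤ v

    module Correct (fits : Fits) where
      open Fits fits

      σ≤2a : σ ≤ 2a
      σ≤2a = ≤-trans σ≤a (m≤m+n a a)

      2a≤J : 2a ≤ J
      2a≤J = m≤m+n 2a (j * 2a)

      J≤T : J ≤ T
      J≤T = m≤m+n J σ'

      J<T : J < T
      J<T = subst (_≤ J + σ') (+-comm J 1) (+-monoʳ-≤ J 1≤σ')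

      σ≤J : σ ≤ J
      σ≤J = ≤-trans σ≤2a 2a≤J

      σ≤T : σ ≤ T
      σ≤T = ≤-trans σ≤J J≤T

      T≤d+σ+2a : T ≤ d + σ + 2a
      T≤d+σ+2a = ≤-trans T≤b+σ+a (≤-reflexive (shuffle a d σ))
        where
        shuffle : ∀ a d σ → a + d + σ + a ≡ d + σ + (a + a)
        shuffle = solve-∀

      wave-gap : ∀ v → J ≤ v → v < T → wave v ≡ false
      wave-gap v J≤v v<T = begin
          wave v                  ≡⟨ cong wave (trans (sym (m+[n∸m]≡n J≤v)) (+-comm J (v ∸ J))) ⟩
          wave (v ∸ J + suc j * 2a) ≡⟨ wave-+*2a (suc j) (v ∸ J) ⟩
          wave (v ∸ J)            ≡⟨ wave-low (v ∸ J) (<-≤-trans v∸J<σ' σ'≤a) ⟩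
          false                   ∎
        where
        open ≡-Reasoning
        v∸J<σ' : v ∸ J < σ'
        v∸J<σ' = +-cancelˡ-< J (v ∸ J) σ' (subst (_< J + σ') (sym (m+[n∸m]≡n J≤v)) v<T)

      profile-run : ∀ v → T ≤ v → v < T + b → profile v ≡ true
      profile-run v T≤v v< = profile-ones v (≤-trans σ≤T T≤v) T≤v v<

      expected-head : ∀ y → y < d + σ → expected y ≡ true
      expected-head y y< with split-d y
      ... | inj₁ y<d = expected-low y y<d
      ... | inj₂ (s , refl) = trans (expected-d+ s) (profile-head s (+-cancelˡ-< d s σ y<))

      private
        profile-+2a : ∀ t → t + 2a < T → profile (t + 2a) ≡ not (wave (t + a))
        profile-+2a t t+2a<T = trans (profile-wave (t + 2a) (≤-trans σ≤2a (m≤n+m 2a t)) t+2a<T)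
                                     (trans (cong wave (sym (+-assoc t a a))) (wave-+a (t + a)))

        profile-+a : ∀ t → t + 2a < T → profile (t + a) ≡ wave (t + a)
        profile-+a t t+2a<T = profile-wave (t + a) (≤-trans σ≤a (m≤n+m a t))
                                           (≤-<-trans (+-monoʳ-≤ t (m≤m+n a a)) t+2a<T)

        -- Inside the wave, a 1 at t + a sits where the state window still shows its
        -- head 1^σ or its upper half 1^a.
        wave⇒expected-+a : ∀ t → t + 2a < T → wave (t + a) ≡ true → expected (t + a) ≡ true
        wave⇒expected-+a t t+2a<T wave≡true with split-d (t + a)
        ... | inj₁ t+a<d = expected-low (t + a) t+a<d
        ... | inj₂ (s , t+a≡) with s <? σ
        ...   | yes s<σ = trans (cong expected t+a≡) (trans (expected-d+ s) (profile-head s s<σ))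
        ...   | no s≮σ = trans (cong expected t+a≡)
                          (trans (expected-d+ s) (trans (profile-wave s σ≤s s<T) (wave-high s a≤s s<2a)))
          where
          open ≤-Reasoning
          σ≤s = ≮⇒≥ s≮σ
          t+2a≡ : t + 2a ≡ d + s + a
          t+2a≡ = trans (sym (+-assoc t a a)) (cong (_+ a) t+a≡)
          s<T : s < T
          s<T = ≤-<-trans (≤-trans (m≤n+m s d) (≤-reflexive (sym t+a≡)))
                          (≤-<-trans (+-monoʳ-≤ t (m≤m+n a a)) t+2a<T)
          a+b≤t+2a : a + b ≤ t + 2a
          a+b≤t+2a = wave-zeros-late (t + 2a) t+2a<T
                       (trans (cong wave (sym (+-assoc t a a))) (trans (wave-+a (t + a)) (cong not wave≡true)))
                       (begin σ + b     ≤⟨ +-monoˡ-≤ b σ≤s ⟩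
                              s + b     ≡⟨ shuffle s a d ⟩
                              d + s + a ≡⟨ sym t+2a≡ ⟩
                              t + 2a    ∎)
            where
            shuffle : ∀ s a d → s + (a + d) ≡ d + s + a
            shuffle = solve-∀
          a≤s : a ≤ s
          a≤s = +-cancelʳ-≤ (a + d) a s (begin
              a + (a + d) ≤⟨ a+b≤t+2a ⟩
              t + 2a      ≡⟨ t+2a≡ ⟩
              d + s + a   ≡⟨ shuffle d s a ⟩
              s + (a + d) ∎)
            where
            shuffle : ∀ d s a → d + s + a ≡ s + (a + d)
            shuffle = solve-∀
          s<2a : s < 2a
          s<2a = <-≤-trans (+-cancelʳ-< (d + a) s (σ + a) (begin-strict
              s + (d + a)   ≡⟨ shuffle d s a ⟩
              d + s + a     ≡⟨ sym t+2a≡ ⟩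
              t + 2a        <⟨ t+2a<T ⟩
              T             ≤⟨ T≤b+σ+a ⟩
              b + σ + a     ≡⟨ shuffle′ a d σ ⟩
              σ + a + (d + a) ∎)) (+-monoˡ-≤ a σ≤a)
            where
            shuffle : ∀ d s a → s + (d + a) ≡ d + s + a
            shuffle = solve-∀
            shuffle′ : ∀ a d σ → a + d + σ + a ≡ σ + a + (d + a)
            shuffle′ = solve-∀

      step-wave : ∀ t → t + 2a < T → profile (t + 2a) ≡ not (profile (t + a) ∧ expected (t + a) ∧ expected t)
      step-wave t t+2a<T = by-value (wave (t + a)) refl
        where
        t<d+σ : t < d + σ
        t<d+σ = +-cancelʳ-< 2a t (d + σ) (<-≤-trans t+2a<T T≤d+σ+2a)
        by-value : ∀ x → wave (t + a) ≡ x → profile (t + 2a) ≡ not (profile (t + a) ∧ expected (t + a) ∧ expected t)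
        by-value false wave≡ = trans (profile-+2a t t+2a<T)
          (trans (cong not wave≡) (sym (nand-0₁ {y = expected (t + a)} {z = expected t} (trans (profile-+a t t+2a<T) wave≡))))
        by-value true wave≡ = trans (profile-+2a t t+2a<T) (trans (cong not wave≡)
          (sym (nand-111 (trans (profile-+a t t+2a<T) wave≡) (wave⇒expected-+a t t+2a<T wave≡) (expected-head t t<d+σ))))

      expected-wave : ∀ s → σ ≤ s → s < T → expected (d + s) ≡ wave s
      expected-wave s σ≤s s<T = trans (expected-d+ s) (profile-wave s σ≤s s<T)

      private
        -- Past the head, t and t + a lie on the wave half a period apart.
        run-past-head : ∀ s → σ ≤ s → d + s + 2a < T + b →
                        not (profile (d + s + a) ∧ expected (d + s + a) ∧ expected (d + s)) ≡ true
        run-past-head s σ≤s t+2a< = by-value (wave s) refl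
          where
          s+a<T : s + a < T
          s+a<T = +-cancelʳ-< (a + d) (s + a) T (subst (_< T + (a + d)) (shuffle d s a) t+2a<)
            where
            shuffle : ∀ d s a → d + s + (a + a) ≡ s + a + (a + d)
            shuffle = solve-∀
          expected-d+s+a : expected (d + s + a) ≡ not (wave s)
          expected-d+s+a = trans (cong expected (+-assoc d s a))
            (trans (expected-wave (s + a) (≤-trans σ≤s (m≤m+n s a)) s+a<T) (wave-+a s))
          by-value : ∀ x → wave s ≡ x → not (profile (d + s + a) ∧ expected (d + s + a) ∧ expected (d + s)) ≡ true
          by-value false wave≡ = nand-0₃ {x = profile (d + s + a)} {y = expected (d + s + a)}
            (trans (expected-wave s σ≤s (≤-<-trans (m≤m+n s a) s+a<T)) wave≡)
          by-value true wave≡ = nand-0₂ {x = profile (d + s + a)} {z = expected (d + s)}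
            (trans expected-d+s+a (cong not wave≡))

        d+σ≤+a : ∀ t → T ≤ t + 2a → d + σ ≤ t + a
        d+σ≤+a t T≤t+2a = +-cancelʳ-≤ a (d + σ) (t + a) (begin
            d + σ + a ≡⟨ shuffle a d σ ⟩
            b + σ     ≤⟨ b+σ≤T ⟩
            T         ≤⟨ T≤t+2a ⟩
            t + 2a    ≡⟨ +-assoc t a a ⟨
            t + a + a ∎)
          where
          open ≤-Reasoning
          shuffle : ∀ a d σ → d + σ + a ≡ a + d + σ
          shuffle = solve-∀

        +a<b+σ : ∀ t → t < d + σ → t + a < b + σ
        +a<b+σ t t<d+σ = subst (t + a <_) (trans (+-comm (d + σ) a) (sym (+-assoc a d σ))) (+-monoˡ-< a t<d+σ)

        -- In the head, t + a has reached either the zeros of the state window or the gap [J, T).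
        run-in-head : ∀ t → t < d + σ → T ≤ t + 2a →
                      not (profile (t + a) ∧ expected (t + a) ∧ expected t) ≡ true
        run-in-head t t<d+σ T≤t+2a with split-d (t + a)
        ... | inj₁ t+a<d = ⊥-elim (<⇒≱ t+a<d (≤-trans (m≤m+n d σ) (d+σ≤+a t T≤t+2a)))
        ... | inj₂ (s , t+a≡) with s <? a
        ...   | yes s<a = nand-0₂ {x = profile (t + a)} {z = expected t}
                  (trans (cong expected t+a≡) (trans (expected-wave s σ≤s s<T) (wave-low s s<a)))
          where
          σ≤s : σ ≤ s
          σ≤s = +-cancelˡ-≤ d σ s (subst (d + σ ≤_) t+a≡ (d+σ≤+a t T≤t+2a))
          s<T : s < T
          s<T = <-≤-trans (+-cancelˡ-< d s (σ + a) (subst₂ _<_ t+a≡ (shuffle a d σ) (+a<b+σ t t<d+σ)))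
                  (≤-trans (≤-reflexive (+-comm σ a)) (≤-trans (+-monoˡ-≤ σ (m≤m+n a d)) b+σ≤T))
            where
            shuffle : ∀ a d σ → a + d + σ ≡ d + (σ + a)
            shuffle = solve-∀
        ...   | no s≮a = nand-0₁ {y = expected (t + a)} {z = expected t}
                  (trans (profile-wave (t + a) (≤-trans σ≤a (m≤n+m a t)) t+a<T) (wave-gap (t + a) J≤t+a t+a<T))
          where
          open ≤-Reasoning
          t+a<T : t + a < T
          t+a<T = <-≤-trans (+a<b+σ t t<d+σ) b+σ≤T
          a+b≤t+2a : a + b ≤ t + 2a
          a+b≤t+2a = begin
            a + (a + d) ≡⟨ shuffle a d ⟩
            d + a + a   ≤⟨ +-monoˡ-≤ a (+-monoʳ-≤ d (≮⇒≥ s≮a)) ⟩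
            d + s + a   ≡⟨ cong (_+ a) (sym t+a≡) ⟩
            t + a + a   ≡⟨ +-assoc t a a ⟩
            t + 2a      ∎
            where
            shuffle : ∀ a d → a + (a + d) ≡ d + a + a
            shuffle = solve-∀
          J≤t+a : J ≤ t + a
          J≤t+a = +-cancelʳ-≤ a J (t + a) (subst (J + a ≤_) (sym (+-assoc t a a))
                    (late-after-J (t + 2a) T≤t+2a a+b≤t+2a
                      (subst (_< b + σ + a) (+-assoc t a a) (+-monoˡ-< a (+a<b+σ t t<d+σ)))))

      step-run : ∀ t → T ≤ t + 2a → t + 2a < T + b →
                 profile (t + 2a) ≡ not (profile (t + a) ∧ expected (t + a) ∧ expected t)
      step-run t T≤t+2a t+2a< with t <? d + σ
      ... | yes t<d+σ = trans (profile-run (t + 2a) T≤t+2a t+2a<) (sym (run-in-head t t<d+σ T≤t+2a))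
      ... | no t≮d+σ with split-d t
      ...   | inj₁ t<d = ⊥-elim (<⇒≱ t<d (≤-trans (m≤m+n d σ) (≮⇒≥ t≮d+σ)))
      ...   | inj₂ (s , refl) = trans (profile-run (t + 2a) T≤t+2a t+2a<)
                                  (sym (run-past-head s (+-cancelˡ-≤ d σ s (≮⇒≥ t≮d+σ)) t+2a<))

      step-zeros : ∀ t → T + b ≤ t + 2a → t + 2a < J + a + b →
                   profile (t + 2a) ≡ not (profile (t + a) ∧ expected (t + a) ∧ expected t)
      step-zeros t T+b≤ t+2a< =
        trans (profile-zeros (t + 2a) (≤-trans σ≤T T≤t+2a) T≤t+2a T+b≤ t+2a<)
              (sym (nand-111 (profile-run (t + a) (≤-trans (m≤m+n T d) T+d≤t+a) t+a<T+b) expected-+a expected-t))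
        where
        T≤t+2a : T ≤ t + 2a
        T≤t+2a = ≤-trans (m≤m+n T b) T+b≤
        T+d≤t+a : T + d ≤ t + a
        T+d≤t+a = +-cancelʳ-≤ a (T + d) (t + a)
                    (≤-trans (≤-reflexive (shuffle T a d)) (≤-trans T+b≤ (≤-reflexive (sym (+-assoc t a a)))))
          where
          shuffle : ∀ x a d → x + d + a ≡ x + (a + d)
          shuffle = solve-∀
        t+a<T+b : t + a < T + b
        t+a<T+b = <-≤-trans (+-cancelʳ-< a (t + a) (J + b) (subst₂ _<_ (sym (+-assoc t a a)) (shuffle J a d) t+2a<))
                            (+-monoˡ-≤ b J≤T)
          where
          shuffle : ∀ J a d → J + a + (a + d) ≡ J + (a + d) + a
          shuffle = solve-∀
        expected-+a : expected (t + a) ≡ true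
        expected-+a with split-d (t + a)
        ... | inj₁ t+a<d = ⊥-elim (<⇒≱ t+a<d (≤-trans (m≤n+m d T) T+d≤t+a))
        ... | inj₂ (s , t+a≡) = trans (cong expected t+a≡) (trans (expected-d+ s) (profile-run s
                (+-cancelʳ-≤ d T s (subst (T + d ≤_) (trans t+a≡ (+-comm d s)) T+d≤t+a))
                (≤-<-trans (≤-trans (m≤n+m s d) (≤-reflexive (sym t+a≡))) t+a<T+b)))
        expected-t : expected t ≡ true
        expected-t with t <? d + σ
        ... | yes t<d+σ = expected-head t t<d+σ
        ... | no t≮d+σ with split-d t
        ...   | inj₁ t<d = ⊥-elim (<⇒≱ t<d (≤-trans (m≤m+n d σ) (≮⇒≥ t≮d+σ)))
        ...   | inj₂ (s , refl) = trans (expected-wave s σ≤s (<-≤-trans s<J J≤T)) (wave-below-J s J≤s+a s<J)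
          where
          σ≤s : σ ≤ s
          σ≤s = +-cancelˡ-≤ d σ s (≮⇒≥ t≮d+σ)
          s<J : s < J
          s<J = +-cancelʳ-< (a + (a + d)) s J (subst₂ _<_ (shuffle d s a) (shuffle′ J a d) t+2a<)
            where
            shuffle : ∀ d s a → d + s + (a + a) ≡ s + (a + (a + d))
            shuffle = solve-∀
            shuffle′ : ∀ J a d → J + a + (a + d) ≡ J + (a + (a + d))
            shuffle′ = solve-∀
          J≤s+a : J ≤ s + a
          J≤s+a = +-cancelʳ-≤ (a + d) J (s + a)
                    (≤-trans (+-monoˡ-≤ (a + d) J≤T) (≤-trans T+b≤ (≤-reflexive (shuffle d s a))))
            where
            shuffle : ∀ d s a → d + s + (a + a) ≡ s + a + (a + d)
            shuffle = solve-∀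

      step-end : ∀ t → J + a + b ≤ t + 2a → t + 2a < J + 2a + b →
                 profile (t + 2a) ≡ not (profile (t + a) ∧ expected (t + a) ∧ expected t)
      step-end t J+a+b≤ t+2a< =
        trans (profile-end (t + 2a) (≤-trans σ≤T T≤t+2a) T≤t+2a T+b≤t+2a J+a+b≤) (sym nand≡true)
        where
        T+b≤t+2a : T + b ≤ t + 2a
        T+b≤t+2a = ≤-trans (+-monoˡ-≤ b (+-monoʳ-≤ J σ'≤a)) J+a+b≤
        T≤t+2a : T ≤ t + 2a
        T≤t+2a = ≤-trans (m≤m+n T b) T+b≤t+2a
        J+d≤t : J + d ≤ t
        J+d≤t = +-cancelʳ-≤ 2a (J + d) t (subst (_≤ t + 2a) (shuffle J a d) J+a+b≤)
          where
          shuffle : ∀ J a d → J + a + (a + d) ≡ J + d + (a + a)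
          shuffle = solve-∀
        nand≡true : not (profile (t + a) ∧ expected (t + a) ∧ expected t) ≡ true
        nand≡true with t + a <? T + b
        ... | no t+a≮ = nand-0₁ {y = expected (t + a)} {z = expected t}
                 (profile-zeros (t + a) (≤-trans σ≤T (≤-trans (m≤m+n T b) (≮⇒≥ t+a≮)))
                                (≤-trans (m≤m+n T b) (≮⇒≥ t+a≮)) (≮⇒≥ t+a≮)
                   (+-cancelʳ-< a (t + a) (J + a + b) (subst₂ _<_ (sym (+-assoc t a a)) (shuffle J a d) t+2a<)))
          where
          shuffle : ∀ J a d → J + (a + a) + (a + d) ≡ J + a + (a + d) + a
          shuffle = solve-∀
        ... | yes t+a< with split-d t
        ...   | inj₁ t<d = ⊥-elim (<⇒≱ t<d (≤-trans (m≤n+m d J) J+d≤t))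
        ...   | inj₂ (s , refl) = nand-0₃ {x = profile (d + s + a)} {y = expected (d + s + a)}
                  (trans (expected-wave s (≤-trans σ≤J J≤s) s<T) (wave-gap s J≤s s<T))
          where
          J≤s : J ≤ s
          J≤s = +-cancelˡ-≤ d J s (subst (_≤ d + s) (+-comm J d) J+d≤t)
          s<T : s < T
          s<T = +-cancelʳ-< (a + d) s T (subst₂ _<_ (shuffle d s a) refl t+a<)
            where
            shuffle : ∀ d s a → d + s + a ≡ s + (a + d)
            shuffle = solve-∀

      profile-step : ∀ t → t + 2a < J + 2a + b →
                     profile (t + 2a) ≡ not (profile (t + a) ∧ expected (t + a) ∧ expected t)
      profile-step t t+2a< with t + 2a <? T
      ... | yes t+2a<T = step-wave t t+2a<T
      ... | no t+2a≮T with t + 2a <? T + b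
      ...   | yes t+2a<T+b = step-run t (≮⇒≥ t+2a≮T) t+2a<T+b
      ...   | no t+2a≮T+b with t + 2a <? J + a + b
      ...     | yes t+2a<J+a+b = step-zeros t (≮⇒≥ t+2a≮T+b) t+2a<J+a+b
      ...     | no t+2a≮J+a+b = step-end t (≮⇒≥ t+2a≮J+a+b) t+2a<

      expected-initial : ∀ y → y < a + b → expected y ≡ state σ y
      expected-initial y y< with y <? d + σ
      ... | yes y<d+σ = trans (expected-head y y<d+σ) (sym (state-head σ y y<d+σ))
      ... | no y≮d+σ with split-d y
      ...   | inj₁ y<d = ⊥-elim (<⇒≱ y<d (≤-trans (m≤m+n d σ) (≮⇒≥ y≮d+σ)))
      ...   | inj₂ (s , refl) with s <? a
      ...     | yes s<a = trans (expected-wave s σ≤s s<T) (trans (wave-low s s<a)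
                            (sym (state-gap σ (d + s) (≮⇒≥ y≮d+σ) (subst (d + s <_) (+-comm d a) (+-monoʳ-< d s<a)))))
        where
        σ≤s = +-cancelˡ-≤ d σ s (≮⇒≥ y≮d+σ)
        s<T = <-≤-trans (<-trans s<a (m<m+n a 1≤a)) (≤-trans 2a≤J J≤T)
      ...     | no s≮a = trans (expected-wave s σ≤s (<-≤-trans s<2a (≤-trans 2a≤J J≤T)))
                            (trans (wave-high s (≮⇒≥ s≮a) s<2a)
                              (sym (state-tail σ (d + s) (≮⇒≥ y≮d+σ)
                                     (subst (_≤ d + s) (+-comm d a) (+-monoʳ-≤ d (≮⇒≥ s≮a))))))
        where
        σ≤s = +-cancelˡ-≤ d σ s (≮⇒≥ y≮d+σ)
        shuffle : ∀ a d → a + (a + d) ≡ d + (a + a)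
        shuffle = solve-∀
        s<2a = +-cancelˡ-< d s 2a (subst (d + s <_) (shuffle a d) y<)

      expected-final : ∀ y → y < a + b → expected (J + b + y) ≡ state σ' y
      expected-final y y< = trans (cong expected (shuffle J a d y)) (trans (expected-d+ (J + a + y)) profile≡state)
        where
        shuffle : ∀ J a d y → J + (a + d) + y ≡ d + (J + a + y)
        shuffle = solve-∀
        shuffle′ : ∀ J σ' a d → J + a + (d + σ') ≡ J + σ' + (a + d)
        shuffle′ = solve-∀
        v = J + a + y
        T≤v : T ≤ v
        T≤v = ≤-trans (+-monoʳ-≤ J σ'≤a) (m≤m+n (J + a) y)
        profile≡state : profile v ≡ state σ' y
        profile≡state with y <? d + σ'
        ... | yes y<d+σ' = trans (profile-run v T≤v (subst (v <_) (shuffle′ J σ' a d) (+-monoʳ-< (J + a) y<d+σ')))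
                                 (sym (state-head σ' y y<d+σ'))
        ... | no y≮d+σ' with y <? b
        ...   | yes y<b = trans (profile-zeros v (≤-trans σ≤T T≤v) T≤v
                                   (subst (_≤ v) (shuffle′ J σ' a d) (+-monoʳ-≤ (J + a) (≮⇒≥ y≮d+σ')))
                                   (+-monoʳ-< (J + a) y<b))
                                (sym (state-gap σ' y (≮⇒≥ y≮d+σ') y<b))
        ...   | no y≮b = trans (profile-end v (≤-trans σ≤T T≤v) T≤v
                                  (≤-trans (+-monoˡ-≤ b (+-monoʳ-≤ J σ'≤a)) (+-monoʳ-≤ (J + a) (≮⇒≥ y≮b)))
                                  (+-monoʳ-≤ (J + a) (≮⇒≥ y≮b)))
                               (sym (state-tail σ' y (≮⇒≥ y≮d+σ') (≮⇒≥ y≮b)))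

      U : ℕ
      U = J + b + (a + b)

      expected-solves : ∀ y → y + (a + b) < U → expected (y + (a + b)) ≡ rule expected y
      expected-solves y y+a+b<U = begin
          expected (y + (a + b))  ≡⟨ cong expected (shuffle y a d) ⟩
          expected (d + (y + 2a)) ≡⟨ expected-d+ (y + 2a) ⟩
          profile (y + 2a)        ≡⟨ profile-step y y+2a< ⟩
          not (profile (y + a) ∧ expected (y + a) ∧ expected y)
            ≡⟨ cong (λ z → not (z ∧ expected (y + a) ∧ expected y))
                    (sym (trans (cong expected (shuffle′ y a d)) (expected-d+ (y + a)))) ⟩
          rule expected y         ∎
        where
        open ≡-Reasoning
        shuffle : ∀ y a d → y + (a + (a + d)) ≡ d + (y + (a + a))
        shuffle = solve-∀
        shuffle′ : ∀ y a d → y + (a + d) ≡ d + (y + a)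
        shuffle′ = solve-∀
        shuffle″ : ∀ y a d → y + (a + (a + d)) ≡ y + (a + a) + d
        shuffle″ = solve-∀
        shuffle‴ : ∀ J a d → J + (a + d) + (a + (a + d)) ≡ J + (a + a) + (a + d) + d
        shuffle‴ = solve-∀
        y+2a< : y + 2a < J + 2a + b
        y+2a< = +-cancelʳ-< d (y + 2a) (J + 2a + b) (subst₂ _<_ (shuffle″ y a d) (shuffle‴ J a d) y+a+b<U)

      private
        σ≤T+ : ∀ m → σ ≤ T + m
        σ≤T+ m = ≤-trans σ≤T (m≤m+n T m)

        at-last-zeros : ∀ m → at (O (a ∸ σ') ++ I a) m ≡ profile (T + b + m)
        at-last-zeros m with at-++ (O (a ∸ σ')) (I a) m
        ... | inj₁ (m< , e) = trans e (trans (at-replicate (a ∸ σ') false m m<a∸σ')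
                (sym (profile-zeros (T + b + m) (≤-trans (σ≤T+ b) (m≤m+n (T + b) m))
                       (≤-trans (m≤m+n T b) (m≤m+n (T + b) m)) (m≤m+n (T + b) m) v<)))
          where
          m<a∸σ' = subst (m <_) (length-replicate (a ∸ σ')) m<
          v< : T + b + m < J + a + b
          v< = begin-strict
              T + b + m        ≡⟨ shuffle J σ' b m ⟩
              J + (σ' + m) + b <⟨ +-monoˡ-< b (+-monoʳ-< J
                                    (subst (σ' + m <_) (m+[n∸m]≡n σ'≤a) (+-monoʳ-< σ' m<a∸σ'))) ⟩
              J + a + b        ∎
            where
            open ≤-Reasoning
            shuffle : ∀ J σ' b m → J + σ' + b + m ≡ J + (σ' + m) + b
            shuffle = solve-∀
        ... | inj₂ (m′ , refl , e) = trans e (trans (at-replicate-true a m′)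
                (sym (profile-end v (≤-trans (σ≤T+ b) (m≤m+n (T + b) _)) (≤-trans (m≤m+n T b) (m≤m+n (T + b) _))
                       (m≤m+n (T + b) _) J+a+b≤v)))
          where
          open ≤-Reasoning
          v = T + b + (length (O (a ∸ σ')) + m′)
          shuffle : ∀ J σ' b x → J + (σ' + x) + b ≡ J + σ' + b + x
          shuffle = solve-∀
          J+a+b≤v : J + a + b ≤ v
          J+a+b≤v = begin
              J + a + b                        ≡⟨ cong (λ z → J + z + b) (sym (m+[n∸m]≡n σ'≤a)) ⟩
              J + (σ' + (a ∸ σ')) + b          ≡⟨ shuffle J σ' b (a ∸ σ') ⟩
              T + b + (a ∸ σ')                 ≡⟨ cong (T + b +_) (sym (length-replicate (a ∸ σ'))) ⟩
              T + b + length (O (a ∸ σ'))      ≤⟨ m≤m+n _ m′ ⟩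
              T + b + length (O (a ∸ σ')) + m′ ≡⟨ +-assoc (T + b) _ m′ ⟩
              v                                ∎

        at-run : ∀ m → at (I b ++ O (a ∸ σ') ++ I a) m ≡ profile (T + m)
        at-run m with at-++ (I b) (O (a ∸ σ') ++ I a) m
        ... | inj₁ (m< , e) = trans e (trans (at-replicate b true m m<b)
                                (sym (profile-run (T + m) (m≤m+n T m) (+-monoʳ-< T m<b))))
          where
          m<b = subst (m <_) (length-replicate b) m<
        ... | inj₂ (m′ , refl , e) = trans e (trans (at-last-zeros m′)
                (trans (cong (λ z → profile (T + z + m′)) (sym (length-replicate b))) (cong profile (+-assoc T _ m′))))

        at-gap : ∀ m → at (O σ' ++ I b ++ O (a ∸ σ') ++ I a) m ≡ profile (J + m)
        at-gap m with at-++ (O σ') (I b ++ O (a ∸ σ') ++ I a) m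
        ... | inj₁ (m< , e) = trans e (trans (at-replicate σ' false m m<σ')
                (sym (trans (profile-wave (J + m) (≤-trans σ≤J (m≤m+n J m)) (+-monoʳ-< J m<σ'))
                            (wave-gap (J + m) (m≤m+n J m) (+-monoʳ-< J m<σ')))))
          where
          m<σ' = subst (m <_) (length-replicate σ') m<
        ... | inj₂ (m′ , refl , e) = trans e (trans (at-run m′)
                (trans (cong (λ z → profile (J + z + m′)) (sym (length-replicate σ'))) (cong profile (+-assoc J _ m′))))

      at-block : ∀ t → at block t ≡ profile (t + 2a)
      at-block t with at-++ (pow square j) (O σ' ++ I b ++ O (a ∸ σ') ++ I a) t
      ... | inj₁ (t< , e) = trans e (trans (at-pow-square j t t<j*2a) (trans (sym (wave-+2a t))
              (sym (profile-wave (t + 2a) (≤-trans σ≤2a (m≤n+m 2a t))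
                     (<-≤-trans (subst (t + 2a <_) (+-comm (j * 2a) 2a) (+-monoˡ-< 2a t<j*2a)) J≤T)))))
        where
        t<j*2a = subst (t <_) (length-pow-square j) t<
      ... | inj₂ (m , refl , e) = trans e (trans (at-gap m)
              (cong profile (trans (cong (_+ m) (trans (+-comm 2a (j * 2a)) (cong (_+ 2a) (sym (length-pow-square j)))))
                                   (shuffle (length (pow square j)) m 2a))))
        where
        shuffle : ∀ x m y → x + y + m ≡ x + m + y
        shuffle = solve-∀

      length-block : length block ≡ J + b
      length-block = begin
          length block
            ≡⟨ length-++ (pow square j) ⟩
          length (pow square j) + length (O σ' ++ I b ++ O (a ∸ σ') ++ I a)
            ≡⟨ cong₂ _+_ (length-pow-square j)
                 (trans (length-++ (O σ')) (cong₂ _+_ (length-replicate σ') (trans (length-++ (I b))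
                   (cong₂ _+_ (length-replicate b) (trans (length-++ (O (a ∸ σ')))
                     (cong₂ _+_ (length-replicate (a ∸ σ')) (length-replicate a))))))) ⟩
          j * 2a + (σ' + (b + ((a ∸ σ') + a)))
            ≡⟨ shuffle (j * 2a) σ' b (a ∸ σ') a ⟩
          j * 2a + (σ' + (a ∸ σ')) + a + b
            ≡⟨ cong (λ z → j * 2a + z + a + b) (m+[n∸m]≡n σ'≤a) ⟩
          j * 2a + a + a + b
            ≡⟨ cong (_+ b) (shuffle′ (j * 2a) a) ⟩
          J + b ∎
        where
        open ≡-Reasoning
        shuffle : ∀ x s b y a → x + (s + (b + (y + a))) ≡ x + (s + y) + a + b
        shuffle = solve-∀
        shuffle′ : ∀ x a → x + a + a ≡ a + a + x
        shuffle′ = solve-∀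

      private
        zero-ahead-head : ∀ y → 1 ≤ y → y < d + σ → ZeroAhead expected y
        zero-ahead-head y 1≤y y<d+σ = zero-at expected y (d + 2a) (≤-trans (<⇒≤ y<d+σ) (+-monoʳ-≤ d σ≤2a))
            (begin-strict d + 2a       <⟨ m<n+m (d + 2a) 1≤y ⟩
                          y + (d + 2a) ≡⟨ cong (y +_) (shuffle a d) ⟩
                          y + (a + b)  ∎)
            (trans (expected-wave 2a σ≤2a (≤-<-trans 2a≤J J<T))
                   (trans (cong wave (sym (+-identityˡ 2a))) (trans (wave-+2a 0) (wave-low 0 1≤a))))
          where
          open ≤-Reasoning
          shuffle : ∀ a d → d + (a + a) ≡ a + (a + d)
          shuffle = solve-∀

        -- On the wave a 0 occurs at v, at v + a, or (if v + a overshoots T) at the start J of the gap.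
        zero-ahead-wave : ∀ v → σ ≤ v → v < T → ZeroAhead expected (d + v)
        zero-ahead-wave v σ≤v v<T = by-value (wave v) refl
          where
          a<a+b = m<m+n a (≤-trans 1≤a (<⇒≤ a<b))
          by-value : ∀ x → wave v ≡ x → ZeroAhead expected (d + v)
          by-value false wave≡ = zero-at expected (d + v) (d + v) ≤-refl (m<m+n (d + v) (≤-trans 1≤a (m≤m+n a b)))
                                   (trans (expected-wave v σ≤v v<T) wave≡)
          by-value true wave≡ with v + a <? T
          ... | yes v+a<T = zero-at expected (d + v) (d + v + a) (m≤m+n (d + v) a) (+-monoʳ-< (d + v) a<a+b)
                  (trans (cong expected (+-assoc d v a)) (trans (expected-wave (v + a) (≤-trans σ≤v (m≤m+n v a)) v+a<T)
                    (trans (wave-+a v) (cong not wave≡))))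
          ... | no v+a≮T = zero-at expected (d + v) (d + J) (+-monoʳ-≤ d (<⇒≤ v<J))
                  (begin-strict d + J       ≤⟨ +-monoʳ-≤ d (≤-trans J≤T (≮⇒≥ v+a≮T)) ⟩
                                d + (v + a) ≡⟨ +-assoc d v a ⟨
                                d + v + a   <⟨ +-monoʳ-< (d + v) a<a+b ⟩
                                d + v + (a + b) ∎)
                  (trans (expected-wave J σ≤J J<T) (wave-gap J ≤-refl J<T))
            where
            open ≤-Reasoning
            v<J : v < J
            v<J with v <? J
            ... | yes v<J = v<J
            ... | no v≮J with trans (sym wave≡) (wave-gap v (≮⇒≥ v≮J) v<T)
            ...   | ()

      expected-zero-ahead : ∀ y → 1 ≤ y → y ≤ J + b → (y < J + b ⊎ σ' < a) → ZeroAhead expected y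
      expected-zero-ahead y 1≤y y≤J+b last with y <? d + σ
      ... | yes y<d+σ = zero-ahead-head y 1≤y y<d+σ
      ... | no y≮d+σ with split-d y
      ...   | inj₁ y<d = ⊥-elim (<⇒≱ y<d (≤-trans (m≤m+n d σ) (≮⇒≥ y≮d+σ)))
      ...   | inj₂ (v , refl) with v <? T
      ...     | yes v<T = zero-ahead-wave v (+-cancelˡ-≤ d σ v (≮⇒≥ y≮d+σ)) v<T
      ...     | no v≮T with v <? T + b
      ...       | yes v<T+b = zero-at expected (d + v) (d + (T + b)) (+-monoʳ-≤ d (<⇒≤ v<T+b))
                    (subst (d + (T + b) <_) (sym (+-assoc d v (a + b))) (+-monoʳ-< d (begin-strict
                       T + b       ≤⟨ +-monoˡ-≤ b (≮⇒≥ v≮T) ⟩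
                       v + b       <⟨ +-monoʳ-< v (m<n+m b 1≤a) ⟩
                       v + (a + b) ∎)))
                    (trans (expected-d+ (T + b))
                      (profile-zeros (T + b) (σ≤T+ b) (m≤m+n T b) ≤-refl (+-monoˡ-< b (+-monoʳ-< J (σ'<a last)))))
        where
        open ≤-Reasoning
        shuffle : ∀ J a d → J + (a + d) ≡ d + (J + a)
        shuffle = solve-∀
        σ'<a : (d + v < J + b ⊎ σ' < a) → σ' < a
        σ'<a (inj₂ σ'<a) = σ'<a
        σ'<a (inj₁ y<J+b) = +-cancelˡ-< J σ' a (≤-<-trans (≮⇒≥ v≮T)
                              (+-cancelˡ-< d v (J + a) (subst (d + v <_) (shuffle J a d) y<J+b)))
      ...       | no v≮T+b = zero-at expected (d + v) (d + v) ≤-refl (m<m+n (d + v) (≤-trans 1≤a (m≤m+n a b)))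
                    (trans (expected-d+ v)
                      (profile-zeros v (≤-trans σ≤T (≮⇒≥ v≮T)) (≮⇒≥ v≮T) (≮⇒≥ v≮T+b) v<J+a+b))
        where
        shuffle : ∀ J a d → J + (a + d) ≡ d + (J + a)
        shuffle = solve-∀
        v<J+a+b : v < J + a + b
        v<J+a+b = ≤-<-trans (+-cancelˡ-≤ d v (J + a) (subst (d + v ≤_) (shuffle J a d) y≤J+b))
                            (m<m+n (J + a) (≤-trans 1≤a (<⇒≤ a<b)))

      module _ (F : ℕ → Bool) (F-solves : Solves F) (Q : ℕ)
               (start : ∀ y → y < a + b → F (Q + y) ≡ state σ y) where

        follows-expected : ∀ y → y < U → F (Q + y) ≡ expected y
        follows-expected = solutions-agree (λ y → F (Q + y)) expected U
          (λ y _ → shift-solves F Q F-solves y) expected-solves (λ y y< → trans (start y y<) (sym (expected-initial y y<)))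

        block-reads : ∀ t → t < length block → F (Q + (a + b) + t) ≡ at block t
        block-reads t t< = begin
            F (Q + (a + b) + t)   ≡⟨ cong F (+-assoc Q (a + b) t) ⟩
            F (Q + (a + b + t))   ≡⟨ follows-expected (a + b + t) (subst (_< U) (+-comm t (a + b))
                                       (+-monoˡ-< (a + b) (subst (t <_) length-block t<))) ⟩
            expected (a + b + t)  ≡⟨ cong expected (shuffle a d t) ⟩
            expected (d + (t + 2a)) ≡⟨ expected-d+ (t + 2a) ⟩
            profile (t + 2a)      ≡⟨ at-block t ⟨
            at block t            ∎
          where
          open ≡-Reasoning
          shuffle : ∀ a d t → a + (a + d) + t ≡ d + (t + (a + a))
          shuffle = solve-∀

        block-leaves : ∀ y → y < a + b → F (Q + length block + y) ≡ state σ' y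
        block-leaves y y< = trans (cong F (trans (cong (λ z → Q + z + y) length-block) (+-assoc Q (J + b) y)))
          (trans (follows-expected (J + b + y) (+-monoʳ-< (J + b) y<)) (expected-final y y<))

        block-zero-ahead : ∀ y → 1 ≤ y → y ≤ length block → (y < length block ⊎ σ' < a) → ZeroAhead F (Q + y)
        block-zero-ahead y 1≤y y≤ last with expected-zero-ahead y 1≤y y≤J+b (map₁ (subst (y <_) length-block) last)
          where y≤J+b = subst (y ≤_) length-block y≤
        ... | i , i< , e = i , i< , trans (cong F (+-assoc Q y i))
                (trans (follows-expected (y + i) (+-mono-≤-< (subst (y ≤_) length-block y≤) i<)) e)

      block-describes : ∀ Q → (∀ y → y < a + b → W (Q + y) ≡ state σ y) → σ' ≡ a → Describes Q block
      block-describes Q start σ'≡a = record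
        { reads = block-reads W W-solves Q start
        ; restarts = λ y y< → trans (block-leaves W W-solves Q start y y<)
                                    (subst (λ s → state s y ≡ true) (sym σ'≡a) (state-a y))
        ; no-restart = λ y 1≤y y< → block-zero-ahead W W-solves Q start y 1≤y (<⇒≤ y<) (inj₁ y<)
        }

-- The two regimes of the theorem

module Main (a d : ℕ) .{{_ : NonZero a}} (1≤a : 1 ≤ a) (1≤d : 1 ≤ d) where
  open Wave a
  open Block a d 1≤a 1≤d

  private
    instance
      2*a≢0 : NonZero (2 * a)
      2*a≢0 = m*n≢0 2 a

  2*a≡2a : 2 * a ≡ 2a
  2*a≡2a = cong (a +_) (+-identityʳ a)

  k : ℕ
  k = kk a b

  -- b = r + 2ak with 1 ≤ r ≤ 2a: r is b mod 2a, except that residue 0 is represented by 2a.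
  r : ℕ
  r = suc ((b ∸ 1) % (2 * a))

  b≡r+k*2a : b ≡ r + k * 2a
  b≡r+k*2a = begin
      b                                ≡⟨ suc-pred b ⟨
      suc (b ∸ 1)                      ≡⟨ cong suc (m≡m%n+[m/n]*n (b ∸ 1) (2 * a)) ⟩
      suc ((b ∸ 1) % (2 * a) + k * (2 * a)) ≡⟨ cong (λ z → r + k * z) 2*a≡2a ⟩
      r + k * 2a                       ∎
    where
    open ≡-Reasoning
    instance
      b≢0 : NonZero b
      b≢0 = >-nonZero (≤-trans 1≤a (m≤m+n a d))

  r≤2a : r ≤ 2a
  r≤2a = subst (r ≤_) 2*a≡2a (m%n<n (b ∸ 1) (2 * a))

  b%2a≡r%2a : b % (2 * a) ≡ r % (2 * a)
  b%2a≡r%2a = trans (cong (_% (2 * a)) (trans b≡r+k*2a (cong (λ z → r + k * z) (sym 2*a≡2a)))) ([m+kn]%n≡m%n r k (2 * a))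

  r<2a⇒b%2a≡r : r < 2a → b % (2 * a) ≡ r
  r<2a⇒b%2a≡r r<2a = trans b%2a≡r%2a (m<n⇒m%n≡m (subst (r <_) (sym 2*a≡2a) r<2a))

  Cond⇒r<a : Cond a b → r < a
  Cond⇒r<a (1≤b%2a , b%2a≤a∸1) with m≤n⇒m<n∨m≡n r≤2a
  ... | inj₁ r<2a = subst (_< a) (r<2a⇒b%2a≡r r<2a) (≤-<-trans b%2a≤a∸1 (∸-monoʳ-< z<s 1≤a))
  ... | inj₂ r≡2a = ⊥-elim (<⇒≱ 1≤b%2a (≤-reflexive
                      (trans b%2a≡r%2a (trans (cong (_% (2 * a)) (trans r≡2a (sym 2*a≡2a))) (n%n≡0 (2 * a))))))

  ¬Cond⇒a≤r : ¬ Cond a b → a ≤ r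
  ¬Cond⇒a≤r ¬cond with r <? a
  ... | no r≮a = ≮⇒≥ r≮a
  ... | yes r<a = ⊥-elim (¬cond (subst (1 ≤_) (sym b%2a≡r) (s≤s z≤n) ,
                                 subst (_≤ a ∸ 1) (sym b%2a≡r) (∸-monoˡ-≤ 1 r<a)))
    where
    b%2a≡r = r<2a⇒b%2a≡r (<-≤-trans r<a (m≤m+n a a))

  module Single (a≤r : a ≤ r) where
    open Profile a a k

    fits : Fits
    fits = record
      { σ≤a = ≤-refl ; 1≤σ' = 1≤a ; σ'≤a = ≤-refl
      ; b+σ≤T = ≤-trans (≤-reflexive (cong (_+ a) b≡r+k*2a)) (+-monoˡ-≤ a (+-monoˡ-≤ (k * 2a) r≤2a))
      ; T≤b+σ+a = ≤-trans (≤-reflexive (shuffle a (k * 2a)))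
          (≤-trans (+-monoˡ-≤ a (+-monoˡ-≤ a (+-monoˡ-≤ (k * 2a) a≤r)))
                   (≤-reflexive (cong (λ z → z + a + a) (sym b≡r+k*2a))))
      ; wave-zeros-late = λ _ _ _ a+b≤v → a+b≤v
      ; late-after-J = λ _ J+a≤v _ _ → J+a≤v
      }
      where
      shuffle : ∀ a x → a + a + x + a ≡ a + x + a + a
      shuffle = solve-∀

    open Correct fits

    block≡word2 : block ≡ word2 a b
    block≡word2 = cong (λ z → pow square k ++ O a ++ z) (begin
        I b ++ O (a ∸ a) ++ I a ≡⟨ cong (λ z → I b ++ O z ++ I a) (n∸n≡0 a) ⟩
        I b ++ I a             ≡⟨ replicate-++ b a true ⟩
        I (b + a)              ≡⟨ cong I (+-comm b a) ⟩
        I (a + b)              ∎)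
      where open ≡-Reasoning

    periodic : SeqIs moves (word2 a b) × PerIs moves (b + 2 * a * (kk a b + 1))
    periodic = subst₂ (λ R p → SeqIs moves R × PerIs moves p) block≡word2 length≡
      (describes⇒periodic block (subst (1 ≤_) (sym length-block) (≤-trans (≤-trans 1≤a (m≤m+n a d)) (m≤n+m b J)))
        (block-describes 0 (λ y y< → trans (W-low y y<) (sym (state-a y))) refl))
      where
      shuffle : ∀ a k b → a + a + k * (a + a) + b ≡ b + 2 * a * (k + 1)
      shuffle = solve-∀
      length≡ : length block ≡ b + 2 * a * (kk a b + 1)
      length≡ = trans length-block (shuffle a k b)

  -- The state after the i-th block is σ_i ∈ [1, a], the representative of i·b ≡ i·r mod a.
  module Chain (cond : Cond a b) where

    r<a : r < a
    r<a = Cond⇒r<a cond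

    1≤r : 1 ≤ r
    1≤r = s≤s z≤n

    k′ : ℕ
    k′ = k ∸ 1

    k≡1+k′ : k ≡ suc k′
    k≡1+k′ with k in k≡
    ... | suc _ = refl
    ... | zero = ⊥-elim (<⇒≱ a<b (≤-trans
                   (≤-reflexive (trans b≡r+k*2a (trans (cong (λ z → r + z * 2a) k≡) (+-identityʳ r))))
                                          (<⇒≤ r<a)))

    b≡r+2a+k′*2a : b ≡ r + (2a + k′ * 2a)
    b≡r+2a+k′*2a = trans b≡r+k*2a (cong (λ z → r + z * 2a) k≡1+k′)

    b%a≡r : b % a ≡ r
    b%a≡r = trans (cong (_% a) (trans b≡r+k*2a (cong (r +_) (shuffle k a))))
                  (trans ([m+kn]%n≡m%n r (k * 2) a) (m<n⇒m%n≡m r<a))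
      where
      shuffle : ∀ k a → k * (a + a) ≡ k * 2 * a
      shuffle = solve-∀

    ã : ℕ
    ã = atilde a b

    open Order a b using ([ã*b]%a≡0; [i*b]%a≢0; 2≤ã)

    1≤ã : 1 ≤ ã
    1≤ã = ≤-trans (s≤s z≤n) (2≤ã (λ b%a≡0 → 1+n≢0 (trans (sym b%a≡r) b%a≡0)))

    record Rep (c σ : ℕ) : Set where
      constructor rep
      field
        1≤σ : 1 ≤ σ
        σ≤a : σ ≤ a
        σ%a≡ : σ % a ≡ (c * b) % a

    Rep-0-a : Rep 0 a
    Rep-0-a = rep 1≤a ≤-refl (trans (n%n≡0 a) (sym (m*n%n≡0 0 a)))

    Rep-0⇒≡a : ∀ {σ} → Rep 0 σ → σ ≡ a
    Rep-0⇒≡a {σ} (rep 1≤σ σ≤a σ%a≡0) with m≤n⇒m<n∨m≡n σ≤a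
    ... | inj₂ σ≡a = σ≡a
    ... | inj₁ σ<a = ⊥-elim (<⇒≱ 1≤σ (≤-reflexive (trans (sym (m<n⇒m%n≡m σ<a)) (trans σ%a≡0 (m*n%n≡0 0 a)))))

    Rep⇒sigma : ∀ {c σ} → 1 ≤ c → c < ã → Rep c σ → sigma a b c ≡ σ
    Rep⇒sigma {c} {σ} 1≤c c<ã (rep _ σ≤a σ%a≡) with m≤n⇒m<n∨m≡n σ≤a
    ... | inj₁ σ<a = trans (sym σ%a≡) (m<n⇒m%n≡m σ<a)
    ... | inj₂ refl = ⊥-elim ([i*b]%a≢0 c 1≤c c<ã (trans (sym σ%a≡) (n%n≡0 a)))

    +r%a : ∀ {c σ} → σ % a ≡ (c * b) % a → (σ + r) % a ≡ (suc c * b) % a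
    +r%a {c} {σ} σ%a≡ = begin
        (σ + r) % a               ≡⟨ %-distribˡ-+ σ r a ⟩
        (σ % a + r % a) % a       ≡⟨ cong₂ (λ x y → (x + y) % a) σ%a≡ (trans (m<n⇒m%n≡m r<a) (sym b%a≡r)) ⟩
        ((c * b) % a + b % a) % a ≡⟨ %-distribˡ-+ (c * b) b a ⟨
        (c * b + b) % a           ≡⟨ cong (_% a) (+-comm (c * b) b) ⟩
        (suc c * b) % a           ∎
      where open ≡-Reasoning

    -- Reaching σ + r ≡ a means returning to 0 modulo a, i.e. to the all-ones state.
    +r%a≡0⇒≡a : ∀ σ → 1 ≤ σ → σ ≤ a → (σ + r) % a ≡ 0 → σ + r ≡ a
    +r%a≡0⇒≡a σ 1≤σ σ≤a ≡0 with <-cmp (σ + r) a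
    ... | tri≈ _ σ+r≡a _ = σ+r≡a
    ... | tri< σ+r<a _ _ =
      ⊥-elim (<⇒≱ (≤-trans 1≤σ (m≤m+n σ r)) (≤-reflexive (trans (sym (m<n⇒m%n≡m σ+r<a)) ≡0)))
    ... | tri> _ _ a<σ+r = ⊥-elim (<⇒≱ (m<n⇒0<n∸m a<σ+r)
            (≤-reflexive (trans (sym (m<n⇒m%n≡m x<a)) (trans (sym ([m+n]%n≡m%n x a)) (trans (cong (_% a) x+a≡) ≡0)))))
      where
      x = σ + r ∸ a
      x+a≡ : x + a ≡ σ + r
      x+a≡ = m∸n+n≡m (<⇒≤ a<σ+r)
      x<a : x < a
      x<a = +-cancelʳ-< a x a (subst (_< a + a) (sym x+a≡) (+-mono-≤-< σ≤a r<a))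

    -- σ + r ≤ a: the block has k - 1 squares and its run 1^b starts at b + σ.
    fits-short : ∀ σ → 1 ≤ σ → σ + r ≤ a → Profile.Fits σ (σ + r) k′
    fits-short σ 1≤σ σ+r≤a = record
      { σ≤a = ≤-trans (m≤m+n σ r) σ+r≤a ; 1≤σ' = ≤-trans 1≤r (m≤n+m r σ) ; σ'≤a = σ+r≤a
      ; b+σ≤T = ≤-reflexive (sym T≡b+σ) ; T≤b+σ+a = ≤-trans (≤-reflexive T≡b+σ) (m≤m+n _ a)
      ; wave-zeros-late = λ v v<T _ σ+b≤v →
          ⊥-elim (<⇒≱ v<T (≤-trans (≤-reflexive T≡b+σ) (≤-trans (≤-reflexive (+-comm b σ)) σ+b≤v)))
      ; late-after-J = λ v _ a+b≤v _ → ≤-trans J+a≤a+b a+b≤v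
      }
      where
      open Profile σ (σ + r) k′
      shuffle : ∀ x k σ r → x + k * x + (σ + r) ≡ r + (x + k * x) + σ
      shuffle = solve-∀
      T≡b+σ : T ≡ b + σ
      T≡b+σ = trans (shuffle 2a k′ σ r) (cong (_+ σ) (sym b≡r+2a+k′*2a))
      J+a≤a+b : J + a ≤ a + b
      J+a≤a+b = ≤-trans (≤-reflexive (+-comm J a))
                        (+-monoʳ-≤ a (≤-trans (m≤n+m J r) (≤-reflexive (sym b≡r+2a+k′*2a))))

    -- a < σ + r: the block has k squares and its run 1^b starts at b + σ + a.
    fits-long : ∀ σ → σ ≤ a → a < σ + r → Profile.Fits σ (σ + r ∸ a) k
    fits-long σ σ≤a a<σ+r = record
      { σ≤a = σ≤a ; 1≤σ' = m<n⇒0<n∸m a<σ+r ; σ'≤a = σ'≤a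
      ; b+σ≤T = ≤-trans (m≤m+n (b + σ) a) (≤-reflexive (sym T≡b+σ+a)) ; T≤b+σ+a = ≤-reflexive T≡b+σ+a
      ; wave-zeros-late = λ v v<T wave≡false σ+b≤v → ≤-trans a+b≤J (J≤ v v<T wave≡false σ+b≤v)
      ; late-after-J = λ v T≤v _ v< → ⊥-elim (<⇒≱ v< (≤-trans (≤-reflexive (sym T≡b+σ+a)) T≤v))
      }
      where
      open Profile σ (σ + r ∸ a) k
      σ' = σ + r ∸ a
      σ'+a≡σ+r : σ' + a ≡ σ + r
      σ'+a≡σ+r = m∸n+n≡m (<⇒≤ a<σ+r)
      σ'≤a : σ' ≤ a
      σ'≤a = +-cancelʳ-≤ a σ' a (≤-trans (≤-reflexive σ'+a≡σ+r) (+-mono-≤ σ≤a (<⇒≤ r<a)))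
      T≡b+σ+a : T ≡ b + σ + a
      T≡b+σ+a = begin
          2a + k * 2a + σ'            ≡⟨ shuffle a k σ' ⟩
          (k * 2a + a) + (σ' + a)     ≡⟨ cong ((k * 2a + a) +_) σ'+a≡σ+r ⟩
          (k * 2a + a) + (σ + r)      ≡⟨ shuffle′ a k σ r ⟩
          r + k * 2a + σ + a          ≡⟨ cong (λ z → z + σ + a) (sym b≡r+k*2a) ⟩
          b + σ + a                   ∎
        where
        open ≡-Reasoning
        shuffle : ∀ a k s → a + a + k * (a + a) + s ≡ k * (a + a) + a + (s + a)
        shuffle = solve-∀
        shuffle′ : ∀ a k σ r → k * (a + a) + a + (σ + r) ≡ r + k * (a + a) + σ + a
        shuffle′ = solve-∀
      a+b≤J : a + b ≤ J
      a+b≤J = ≤-trans (≤-reflexive (cong (a +_) b≡r+k*2a))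
                (≤-trans (≤-reflexive (sym (+-assoc a r (k * 2a)))) (+-monoˡ-≤ (k * 2a) (+-monoʳ-≤ a (<⇒≤ r<a))))
      -- Below J the wave is 0 only in the lower halves of its squares, and σ + b ≥ a + k·2a
      -- lies in the upper half of the last square before J.
      J≤ : ∀ v → v < T → wave v ≡ false → σ + b ≤ v → J ≤ v
      J≤ v v<T wave≡false σ+b≤v with v <? J
      ... | no v≮J = ≮⇒≥ v≮J
      ... | yes v<J = ⊥-elim (true≢false (trans (sym (wave-below-J v J≤v+a v<J)) wave≡false))
        where
        true≢false : true ≢ false
        true≢false ()
        open ≤-Reasoning
        shuffle : ∀ a x → x + a + a ≡ a + a + x
        shuffle = solve-∀
        shuffle′ : ∀ σ r x → r + σ + x ≡ σ + (r + x)
        shuffle′ = solve-∀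
        J≤v+a : J ≤ v + a
        J≤v+a = begin
          2a + k * 2a      ≡⟨ shuffle a (k * 2a) ⟨
          k * 2a + a + a   ≤⟨ +-monoˡ-≤ a (begin
            k * 2a + a       ≡⟨ +-comm (k * 2a) a ⟩
            a + k * 2a       ≤⟨ +-monoˡ-≤ (k * 2a) (<⇒≤ (subst (a <_) (+-comm σ r) a<σ+r)) ⟩
            r + σ + k * 2a   ≡⟨ shuffle′ σ r (k * 2a) ⟩
            σ + (r + k * 2a) ≡⟨ cong (σ +_) b≡r+k*2a ⟨
            σ + b            ≤⟨ σ+b≤v ⟩
            v                ∎) ⟩
          v + a            ∎

    K : ℕ
    K = 3 * b ∸ 2 * kk a b * a

    K≡3r+2k2a : K ≡ 3 * r + 2 * (k * 2a)
    K≡3r+2k2a = begin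
        3 * b ∸ 2 * k * a                        ≡⟨ cong₂ _∸_ (cong (3 *_) b≡r+k*2a) (shuffle k a) ⟩
        3 * (r + k * 2a) ∸ k * 2a                ≡⟨ cong (_∸ k * 2a) (shuffle′ r (k * 2a)) ⟩
        3 * r + 2 * (k * 2a) + k * 2a ∸ k * 2a   ≡⟨ m+n∸n≡m _ (k * 2a) ⟩
        3 * r + 2 * (k * 2a)                     ∎
      where
      open ≡-Reasoning
      shuffle : ∀ k a → 2 * k * a ≡ k * (a + a)
      shuffle = solve-∀
      shuffle′ : ∀ r x → 3 * (r + x) ≡ 3 * r + 2 * x + x
      shuffle′ = solve-∀

    Rep-+r : ∀ {c σ} → Rep c σ → σ + r ≤ a → Rep (suc c) (σ + r)
    Rep-+r {c} (rep _ _ σ%a≡) σ+r≤a = rep (≤-trans 1≤r (m≤n+m r _)) σ+r≤a (+r%a {c} σ%a≡)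

    Rep-+r∸a : ∀ {c σ} → Rep c σ → a < σ + r → Rep (suc c) (σ + r ∸ a)
    Rep-+r∸a {c} {σ} (rep _ σ≤a σ%a≡) a<σ+r = rep
      (m<n⇒0<n∸m a<σ+r)
      (+-cancelʳ-≤ a (σ + r ∸ a) a (≤-trans (≤-reflexive (m∸n+n≡m (<⇒≤ a<σ+r))) (+-mono-≤ σ≤a (<⇒≤ r<a))))
      (trans (sym ([m+n]%n≡m%n (σ + r ∸ a) a)) (trans (cong (_% a) (m∸n+n≡m (<⇒≤ a<σ+r))) (+r%a {c} σ%a≡)))

    +r∸a< : ∀ σ → a < σ + r → σ + r ∸ a < σ
    +r∸a< σ a<σ+r = +-cancelʳ-< a (σ + r ∸ a) σ (subst (_< σ + a) (sym (m∸n+n≡m (<⇒≤ a<σ+r))) (+-monoʳ-< σ r<a))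

    delta-short : ∀ c σ → Rep c σ → suc c < ã → σ + r < a → delta a b (suc c) ≡ 1
    delta-short zero σ ρ _ σ+r<a = ⊥-elim (<⇒≱ σ+r<a (subst (λ s → a ≤ s + r) (sym (Rep-0⇒≡a ρ)) (m≤m+n a r)))
    delta-short (suc c) σ ρ 2+c<ã σ+r<a
      rewrite Rep⇒sigma (s≤s z≤n) (<-trans (n<1+n _) 2+c<ã) ρ
            | Rep⇒sigma (s≤s z≤n) 2+c<ã (Rep-+r ρ (<⇒≤ σ+r<a))
            | <ᵇ-true (m<m+n σ 1≤r) = refl

    delta-long : ∀ c σ → Rep c σ → suc c < ã → a < σ + r → delta a b (suc c) ≡ 0
    delta-long zero σ _ _ _ = refl
    delta-long (suc c) σ ρ 2+c<ã a<σ+r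
      rewrite Rep⇒sigma (s≤s z≤n) (<-trans (n<1+n _) 2+c<ã) ρ
            | Rep⇒sigma (s≤s z≤n) 2+c<ã (Rep-+r∸a ρ a<σ+r)
            | <ᵇ-false (<⇒≤ (+r∸a< σ a<σ+r)) = refl

    record Transition (c σ : ℕ) : Set where
      field
        σ' j : ℕ
        fits : Profile.Fits σ σ' j
        rep′ : Rep (suc c) σ'
        σ'<a : σ' < a
        X≡block : Xw a b (suc c) ≡ Profile.block σ σ' j
        length-step : Profile.J σ σ' j + b + 2 * σ' ≡ K + 2 * σ

    Xw≡block : ∀ c σ σ' j → sigma a b (suc c) ≡ σ' → k ∸ delta a b (suc c) ≡ j →
               Xw a b (suc c) ≡ Profile.block σ σ' j
    Xw≡block c σ σ' j sigma≡ k∸δ≡ = cong₂ (λ x y → pow square x ++ O y ++ I b ++ O (a ∸ y) ++ I a) k∸δ≡ sigma≡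

    transition : ∀ c σ → Rep c σ → suc c < ã → Transition c σ
    transition c σ ρ 1+c<ã with σ + r ≤? a
    ... | yes σ+r≤a = record
      { σ' = σ + r ; j = k′ ; fits = fits-short σ (Rep.1≤σ ρ) σ+r≤a ; rep′ = ρ′ ; σ'<a = σ+r<a
      ; X≡block = Xw≡block c σ (σ + r) k′ (Rep⇒sigma (s≤s z≤n) 1+c<ã ρ′)
                    (cong (k ∸_) (delta-short c σ ρ 1+c<ã σ+r<a))
      ; length-step = begin
          2a + k′ * 2a + b + 2 * (σ + r)  ≡⟨ cong (λ z → 2a + k′ * 2a + z + 2 * (σ + r)) b≡r+2a+k′*2a ⟩
          2a + k′ * 2a + (r + (2a + k′ * 2a)) + 2 * (σ + r) ≡⟨ shuffle a k′ r σ ⟩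
          3 * r + 2 * (suc k′ * 2a) + 2 * σ ≡⟨ cong (λ z → 3 * r + 2 * (z * 2a) + 2 * σ) k≡1+k′ ⟨
          3 * r + 2 * (k * 2a) + 2 * σ    ≡⟨ cong (_+ 2 * σ) K≡3r+2k2a ⟨
          K + 2 * σ                       ∎
      }
      where
      open ≡-Reasoning
      ρ′ = Rep-+r ρ σ+r≤a
      σ+r<a : σ + r < a
      σ+r<a = ≤∧≢⇒< σ+r≤a (λ σ+r≡a → [i*b]%a≢0 (suc c) (s≤s z≤n) 1+c<ã
                (trans (sym (Rep.σ%a≡ ρ′)) (trans (cong (_% a) σ+r≡a) (n%n≡0 a))))
      shuffle : ∀ a k r σ → a + a + k * (a + a) + (r + (a + a + k * (a + a))) + 2 * (σ + r)
                            ≡ 3 * r + 2 * (suc k * (a + a)) + 2 * σ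
      shuffle = solve-∀
    ... | no σ+r≰a = record
      { σ' = σ + r ∸ a ; j = k ; fits = fits-long σ (Rep.σ≤a ρ) a<σ+r ; rep′ = ρ′ ; σ'<a = σ'<a
      ; X≡block = Xw≡block c σ (σ + r ∸ a) k (Rep⇒sigma (s≤s z≤n) 1+c<ã ρ′)
                    (cong (k ∸_) (delta-long c σ ρ 1+c<ã a<σ+r))
      ; length-step = +-cancelʳ-≡ (2 * a) _ _ (begin
          2a + k * 2a + b + 2 * σ' + 2 * a      ≡⟨ +-assoc (2a + k * 2a + b) (2 * σ') (2 * a) ⟩
          2a + k * 2a + b + (2 * σ' + 2 * a)    ≡⟨ cong (2a + k * 2a + b +_) (*-distribˡ-+ 2 σ' a) ⟨
          2a + k * 2a + b + 2 * (σ' + a)        ≡⟨ cong₂ (λ x y → 2a + k * 2a + x + 2 * y) b≡r+k*2a σ'+a≡σ+r ⟩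
          2a + k * 2a + (r + k * 2a) + 2 * (σ + r) ≡⟨ shuffle a k r σ ⟩
          3 * r + 2 * (k * 2a) + 2 * σ + 2 * a  ≡⟨ cong (λ z → z + 2 * σ + 2 * a) K≡3r+2k2a ⟨
          K + 2 * σ + 2 * a                     ∎)
      }
      where
      open ≡-Reasoning
      a<σ+r = ≰⇒> σ+r≰a
      σ' = σ + r ∸ a
      ρ′ = Rep-+r∸a ρ a<σ+r
      σ'+a≡σ+r : σ' + a ≡ σ + r
      σ'+a≡σ+r = m∸n+n≡m (<⇒≤ a<σ+r)
      σ'<a : σ' < a
      σ'<a = +-cancelʳ-< a σ' a (subst (_< a + a) (sym σ'+a≡σ+r) (+-mono-≤-< (Rep.σ≤a ρ) r<a))
      shuffle : ∀ a k r σ → a + a + k * (a + a) + (r + k * (a + a)) + 2 * (σ + r)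
                            ≡ 3 * r + 2 * (k * (a + a)) + 2 * σ + 2 * a
      shuffle = solve-∀

    finalBlock : List Bool
    finalBlock = pow square k ++ I b

    final-block : ∀ σ → Profile.block σ a k′ ≡ finalBlock
    final-block σ = begin
        pow square k′ ++ O a ++ I b ++ O (a ∸ a) ++ I a
          ≡⟨ cong (λ z → pow square k′ ++ O a ++ I b ++ O z ++ I a) (n∸n≡0 a) ⟩
        pow square k′ ++ O a ++ I b ++ I a             ≡⟨ cong (λ z → pow square k′ ++ O a ++ z) I-swap ⟩
        pow square k′ ++ O a ++ I a ++ I b             ≡⟨ cong (pow square k′ ++_) (++-assoc (O a) (I a) (I b)) ⟨
        pow square k′ ++ square ++ I b                 ≡⟨ ++-assoc (pow square k′) square (I b) ⟨
        (pow square k′ ++ square) ++ I b               ≡⟨ cong (_++ I b) (pow-suc square k′) ⟨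
        pow square (suc k′) ++ I b                     ≡⟨ cong (λ z → pow square z ++ I b) k≡1+k′ ⟨
        finalBlock                                     ∎
      where
      open ≡-Reasoning
      I-swap : I b ++ I a ≡ I a ++ I b
      I-swap = trans (replicate-++ b a true) (trans (cong I (+-comm b a)) (sym (replicate-++ a b true)))

    final-length : ∀ σ → σ + r ≡ a → length finalBlock + 2 * a ≡ K + 2 * σ
    final-length σ σ+r≡a = begin
        length finalBlock + 2 * a            ≡⟨ cong₂ _+_ length-final (cong (2 *_) (sym σ+r≡a)) ⟩
        k * 2a + b + 2 * (σ + r)             ≡⟨ cong (λ z → k * 2a + z + 2 * (σ + r)) b≡r+k*2a ⟩
        k * 2a + (r + k * 2a) + 2 * (σ + r)  ≡⟨ shuffle a k r σ ⟩
        3 * r + 2 * (k * 2a) + 2 * σ         ≡⟨ cong (_+ 2 * σ) K≡3r+2k2a ⟨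
        K + 2 * σ                            ∎
      where
      open ≡-Reasoning
      length-final : length finalBlock ≡ k * 2a + b
      length-final = trans (length-++ (pow square k)) (cong₂ _+_ (length-pow-square k) (length-replicate b))
      shuffle : ∀ a k r σ → k * (a + a) + (r + k * (a + a)) + 2 * (σ + r) ≡ 3 * r + 2 * (k * (a + a)) + 2 * σ
      shuffle = solve-∀

    last-state : ∀ c σ → Rep c σ → suc c ≡ ã → σ + r ≡ a
    last-state c σ (rep 1≤σ σ≤a σ%a≡) 1+c≡ã =
      +r%a≡0⇒≡a σ 1≤σ σ≤a (trans (+r%a {c} σ%a≡) (subst (λ z → (z * b) % a ≡ 0) (sym 1+c≡ã) [ã*b]%a≡0))

    final-fits : ∀ σ → 1 ≤ σ → σ + r ≡ a → Profile.Fits σ a k′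
    final-fits σ 1≤σ σ+r≡a = subst (λ s → Profile.Fits σ s k′) σ+r≡a (fits-short σ 1≤σ (≤-reflexive σ+r≡a))

    blocks : ℕ → ℕ → List Bool
    blocks c zero = finalBlock
    blocks c (suc n) = Xw a b (suc c) ++ blocks (suc c) n

    blocks-applyUpTo : ∀ (g : ℕ → ℕ) c n → (∀ i → g i ≡ c + i) →
                       concat (map (λ i → Xw a b (suc i)) (applyUpTo g n)) ++ finalBlock ≡ blocks c n
    blocks-applyUpTo g c zero _ = refl
    blocks-applyUpTo g c (suc n) g≡ = begin
        (Xw a b (suc (g 0)) ++ concat (map (λ i → Xw a b (suc i)) (applyUpTo (λ i → g (suc i)) n))) ++ finalBlock
          ≡⟨ ++-assoc (Xw a b (suc (g 0))) _ finalBlock ⟩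
        Xw a b (suc (g 0)) ++ concat (map (λ i → Xw a b (suc i)) (applyUpTo (λ i → g (suc i)) n)) ++ finalBlock
          ≡⟨ cong₂ (λ x y → Xw a b (suc x) ++ y) (trans (g≡ 0) (+-identityʳ c))
                   (blocks-applyUpTo (λ i → g (suc i)) (suc c) n (λ i → trans (g≡ (suc i)) (+-suc c i))) ⟩
        Xw a b (suc c) ++ blocks (suc c) n ∎
      where open ≡-Reasoning

    word1≡blocks : word1 a b ≡ blocks 0 (ã ∸ 1)
    word1≡blocks = blocks-applyUpTo (λ i → i) 0 (ã ∸ 1) (λ _ → refl)

    describes-blocks : ∀ n c σ Q → suc (c + n) ≡ ã → Rep c σ →
                       (∀ y → y < a + b → W (Q + y) ≡ state σ y) → Describes Q (blocks c n)
    describes-blocks zero c σ Q 1+c+0≡ã ρ start =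
      subst (Describes Q) (final-block σ) (Correct.block-describes fits Q start refl)
      where
      σ+r≡a = last-state c σ ρ (trans (cong suc (sym (+-identityʳ c))) 1+c+0≡ã)
      fits = final-fits σ (Rep.1≤σ ρ) σ+r≡a
      open Profile σ a k′
    describes-blocks (suc n) c σ Q 1+c+1+n≡ã ρ start =
      subst (λ X → Describes Q (X ++ blocks (suc c) n)) (sym X≡block)
        (Describes-++ Q block (blocks (suc c) n) (block-reads W W-solves Q start)
          (λ y 1≤y y≤ → block-zero-ahead W W-solves Q start y 1≤y y≤ (inj₂ σ'<a))
          (describes-blocks n (suc c) σ' (Q + length block) (trans (cong suc (sym (+-suc c n))) 1+c+1+n≡ã) rep′
            (block-leaves W W-solves Q start)))
      where
      1+c<ã : suc c < ã
      1+c<ã = subst (suc c <_) 1+c+1+n≡ã (s≤s (subst (c <_) (sym (+-suc c n)) (s≤s (m≤m+n c n))))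
      open Transition (transition c σ ρ 1+c<ã)
      open Profile σ σ' j
      open Correct fits

    length-blocks : ∀ n c σ → suc (c + n) ≡ ã → Rep c σ → length (blocks c n) + 2 * a ≡ suc n * K + 2 * σ
    length-blocks zero c σ 1+c+0≡ã ρ =
      trans (final-length σ (last-state c σ ρ (trans (cong suc (sym (+-identityʳ c))) 1+c+0≡ã)))
            (cong (_+ 2 * σ) (sym (+-identityʳ K)))
    length-blocks (suc n) c σ 1+c+1+n≡ã ρ = begin
        length (Xw a b (suc c) ++ rest) + 2 * a     ≡⟨ cong (_+ 2 * a) (length-++ (Xw a b (suc c))) ⟩
        length (Xw a b (suc c)) + length rest + 2 * a ≡⟨ +-assoc (length (Xw a b (suc c))) (length rest) (2 * a) ⟩
        length (Xw a b (suc c)) + (length rest + 2 * a)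
          ≡⟨ cong₂ _+_ (trans (cong length X≡block) length-block)
                       (length-blocks n (suc c) σ' (trans (cong suc (sym (+-suc c n))) 1+c+1+n≡ã) rep′) ⟩
        J + b + (suc n * K + 2 * σ')                ≡⟨ shuffle (J + b) (suc n * K) σ' ⟩
        J + b + 2 * σ' + suc n * K                  ≡⟨ cong (_+ suc n * K) length-step ⟩
        K + 2 * σ + suc n * K                       ≡⟨ shuffle′ K σ (suc n * K) ⟩
        suc (suc n) * K + 2 * σ                     ∎
      where
      open ≡-Reasoning
      rest = blocks (suc c) n
      1+c<ã : suc c < ã
      1+c<ã = subst (suc c <_) 1+c+1+n≡ã (s≤s (subst (c <_) (sym (+-suc c n)) (s≤s (m≤m+n c n))))
      open Transition (transition c σ ρ 1+c<ã)
      open Profile σ σ' j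
      open Correct fits
      shuffle : ∀ X Y s → X + (Y + 2 * s) ≡ X + 2 * s + Y
      shuffle = solve-∀
      shuffle′ : ∀ K s Y → K + 2 * s + Y ≡ K + Y + 2 * s
      shuffle′ = solve-∀

    periodic : SeqIs moves (word1 a b) × PerIs moves (atilde a b * (3 * b ∸ 2 * kk a b * a))
    periodic = subst₂ (λ R p → SeqIs moves R × PerIs moves p) (sym word1≡blocks) length≡ã*K
      (describes⇒periodic (blocks 0 (ã ∸ 1))
        (subst (1 ≤_) (sym length≡ã*K) (*-mono-≤ 1≤ã 1≤K))
        (describes-blocks (ã ∸ 1) 0 a 0 1+[ã∸1]≡ã Rep-0-a (λ y y< → trans (W-low y y<) (sym (state-a y)))))
      where
      1≤K : 1 ≤ K
      1≤K = subst (1 ≤_) (sym K≡3r+2k2a) (≤-trans (*-mono-≤ {1} {3} (s≤s z≤n) 1≤r) (m≤m+n _ _))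
      1+[ã∸1]≡ã : suc (ã ∸ 1) ≡ ã
      1+[ã∸1]≡ã = m+[n∸m]≡n 1≤ã
      length≡ã*K : length (blocks 0 (ã ∸ 1)) ≡ ã * K
      length≡ã*K = +-cancelʳ-≡ (2 * a) _ _ (trans (length-blocks (ã ∸ 1) 0 a 1+[ã∸1]≡ã Rep-0-a)
                                                  (cong (λ z → z * K + 2 * a) 1+[ã∸1]≡ã))

theorem5p1 : (a b : ℕ) .{{_ : NonZero a}} → a < b →
    (Cond a b → SeqIs (a ∷ b ∷ (a + b) ∷ []) (word1 a b)
                × PerIs (a ∷ b ∷ (a + b) ∷ []) (atilde a b * (3 * b ∸ 2 * kk a b * a)))
    × (¬ Cond a b → SeqIs (a ∷ b ∷ (a + b) ∷ []) (word2 a b)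
                × PerIs (a ∷ b ∷ (a + b) ∷ []) (b + 2 * a * (kk a b + 1)))
theorem5p1 a b a<b = subst Claim (m+[n∸m]≡n (<⇒≤ a<b))
  ((λ cond → Chain.periodic cond) , (λ ¬cond → Single.periodic (¬Cond⇒a≤r ¬cond)))
  where
  open Main a (b ∸ a) (>-nonZero⁻¹ a) (m<n⇒0<n∸m a<b)
  Claim : ℕ → Set
  Claim b = (Cond a b → SeqIs (a ∷ b ∷ (a + b) ∷ []) (word1 a b)
                        × PerIs (a ∷ b ∷ (a + b) ∷ []) (atilde a b * (3 * b ∸ 2 * kk a b * a)))
            × (¬ Cond a b → SeqIs (a ∷ b ∷ (a + b) ∷ []) (word2 a b)
                        × PerIs (a ∷ b ∷ (a + b) ∷ []) (b + 2 * a * (kk a b + 1)))
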